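{- Let $x\geq 3$ be an odd integer. Then there exists a standard linear realization of $\{1^a,x^b,(x+1)^c\}$ in each of the following cases: (1) $b,c\geq 0$ and $a\geq 3x-3$; (2) $b,c\geq 0$ and $a\geq b+2x-3$; (3) $b\geq 0$, $c\geq \frac{4b}{3}$ and $a\geq 2x-2$.
   Context: The notation $\{1^{a_1},\ldots,t^{a_t}\}$ denotes the multiset with $a_i$ copies of $i$. For a list (multiset) $L$ of positive integers with $|L|$ elements, a linear realization of $L$ is an ordering $[x_0,\ldots,x_{|L|}]$ of $\{0,1,\ldots,|L|\}$ such that the multiset $\{|x_i-x_{i+1}|:0\le i\le |L|-1\}$ equals $L$; it is standard if $x_0=0$. All exponents are integers. -}

module Defs where

open import Data.Nat using (ℕ; zero; suc; _+_; ∣_-_∣)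
open import Data.List using (List; []; _∷_; length; upTo; replicate; _++_)
open import Data.Product using (_×_)
open import Data.Maybe using (just)
open import Data.List using (head)
open import Relation.Binary.PropositionalEquality using (_≡_)
open import Data.List.Relation.Binary.Permutation.Propositional using (_↭_)

consecutiveDiffs : List ℕ → List ℕ
consecutiveDiffs []           = []
consecutiveDiffs (x ∷ [])     = []
consecutiveDiffs (x ∷ y ∷ xs) = ∣ x - y ∣ ∷ consecutiveDiffs (y ∷ xs)

-- multisets are lists up to permutation (_↭_)
-- a linear realization of L: an ordering of {0,...,|L|} whose consecutive
-- differences form the multiset L
IsLinearRealization : List ℕ → List ℕ → Set
IsLinearRealization L xs = (xs ↭ upTo (suc (length L))) × (consecutiveDiffs xs ↭ L)

IsStandardLinearRealization : List ℕ → List ℕ → Set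
IsStandardLinearRealization L xs = IsLinearRealization L xs × (head xs ≡ just 0)

L3 : ℕ → ℕ → ℕ → ℕ → List ℕ
L3 x a b c = replicate a 1 ++ replicate b x ++ replicate c (suc x)

-- The proof is an explicit construction.  A realization of M on [0, N] is
-- built as a walk from 0 (Walk, Realization); realizations that end at their
-- maximum (Perfect) can be followed by any other realization shifted up.
-- Most pieces are snakes through columns j, j+w, …, j+gw of step w, which
-- tile intervals (columns-grid) and use only jumps 1 and w.
-- Writing b = m x + r with r < x, the realization is a run of 1's, then an
-- x-snake (cases 1, 2) or m mixed blocks (case 3), then the tail for (r, c);
-- each hypothesis of the theorem leaves enough 1's (realizationL3).

module Submission where

open import Defs
open import Data.Nat using (ℕ; zero; suc; pred; _+_; _*_; _∸_; _≥_; _≤_; _<_; ∣_-_∣; s≤s; z≤n)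
open import Data.Nat.Properties using (0≢1+n; ≤⇒≯; *-distribˡ-+; *-monoʳ-≤; *-cancelˡ-≤; +-cancelˡ-≡; ≤-reflexive; ≰⇒>; n≤1+n; <-cmp; _≤?_; +-monoˡ-≤; +-monoʳ-≤; m+n∸n≡m; *-comm; *-identityʳ; +-comm; +-assoc; +-suc; +-identityʳ; ∣m-m+n∣≡n; ∣-∣-comm; ∣m+n-m+o∣≡∣n-o∣; +-cancelʳ-≡; ≤-pred; ≤-trans; m≤m+n; m≤n+m; <-irrefl; ≤-refl)
open import Data.Nat.DivMod using (_%_; _/_; [m+n]%n≡m%n; m%n<n; m≡m%n+[m/n]*n)
open import Data.Nat.Tactic.RingSolver using (solve-∀)
open import Data.Empty using (⊥; ⊥-elim)
open import Relation.Nullary using (yes; no)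
open import Relation.Binary.Definitions using (tri<; tri≈; tri>)
open import Data.List using (List; []; _∷_; _++_; map; replicate; upTo; applyUpTo; length)
import Data.List.Properties as LP
open import Data.List.Relation.Binary.Permutation.Propositional using (_↭_; ↭-refl; ↭-sym; ↭-trans; ↭-reflexive; prep; swap)
import Data.List.Relation.Binary.Permutation.Propositional.Properties as PP
open import Data.Product using (Σ; _×_; _,_)
open import Data.Sum using (_⊎_; inj₁; inj₂)
open import Relation.Binary.PropositionalEquality using (_≡_; refl; sym; trans; cong; cong₂; subst; module ≡-Reasoning)
import Algebra.Solver.CommutativeMonoid as CMSolver

open CMSolver (PP.++-commutativeMonoid {A = ℕ}) using (solve; _⊕_; _⊜_)

-- A Walk records the jump multiset (up to
-- permutation) and the end point, so that walks can be concatenated.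

diffsFrom : ℕ → List ℕ → List ℕ
diffsFrom e [] = []
diffsFrom e (v ∷ vs) = ∣ e - v ∣ ∷ diffsFrom v vs

lastFrom : ℕ → List ℕ → ℕ
lastFrom e [] = e
lastFrom e (v ∷ vs) = lastFrom v vs

consecutiveDiffs≡diffsFrom : ∀ e vs → consecutiveDiffs (e ∷ vs) ≡ diffsFrom e vs
consecutiveDiffs≡diffsFrom e [] = refl
consecutiveDiffs≡diffsFrom e (v ∷ vs) = cong (∣ e - v ∣ ∷_) (consecutiveDiffs≡diffsFrom v vs)

diffsFrom-++ : ∀ e xs ys → diffsFrom e (xs ++ ys) ≡ diffsFrom e xs ++ diffsFrom (lastFrom e xs) ys
diffsFrom-++ e [] ys = refl
diffsFrom-++ e (v ∷ xs) ys = cong (∣ e - v ∣ ∷_) (diffsFrom-++ v xs ys)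

lastFrom-++ : ∀ e xs ys → lastFrom e (xs ++ ys) ≡ lastFrom (lastFrom e xs) ys
lastFrom-++ e [] ys = refl
lastFrom-++ e (v ∷ xs) ys = lastFrom-++ v xs ys

record Walk (e : ℕ) (xs : List ℕ) (t : ℕ) (M : List ℕ) : Set where
  constructor _,_
  field
    diffs : diffsFrom e xs ↭ M
    ends : lastFrom e xs ≡ t

walk-++ : ∀ {e xs t M ys t' M'} → Walk e xs t M → Walk t ys t' M' → Walk e (xs ++ ys) t' (M ++ M')
walk-++ {e} {xs} {t} {M} {ys} (p1 , q1) (p2 , q2) =
  subst (λ z → z ↭ _) (sym (diffsFrom-++ e xs ys))
    (PP.++⁺ p1 (subst (λ z → diffsFrom z ys ↭ _) (sym q1) p2)) ,
  trans (lastFrom-++ e xs ys) (trans (cong (λ z → lastFrom z ys) q1) q2)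

walk-↭ : ∀ {e xs t M M'} → Walk e xs t M → M ↭ M' → Walk e xs t M'
walk-↭ (p , q) r = ↭-trans p r , q

walk-end : ∀ {e xs t t' M} → Walk e xs t M → t ≡ t' → Walk e xs t' M
walk-end (p , q) r = p , trans q r

walk-start : ∀ {e e' xs t M} → Walk e xs t M → e ≡ e' → Walk e' xs t M
walk-start p refl = p

walk-[] : ∀ e → Walk e [] e []
walk-[] e = ↭-refl , refl

∷⁺↭ : ∀ {a b : ℕ} {xs ys} → a ≡ b → xs ↭ ys → a ∷ xs ↭ b ∷ ys
∷⁺↭ refl p = prep _ p

single-walk : ∀ e v d → ∣ e - v ∣ ≡ d → Walk e (v ∷ []) v (d ∷ [])
single-walk e v d h = ∷⁺↭ h ↭-refl , refl

∣m+n-m∣≡n : ∀ m n → ∣ (m + n) - m ∣ ≡ n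
∣m+n-m∣≡n m n = trans (∣-∣-comm (m + n) m) (∣m-m+n∣≡n m n)

∣n-1+n∣≡1 : ∀ n → ∣ n - suc n ∣ ≡ 1
∣n-1+n∣≡1 n = trans (cong (λ z → ∣ n - z ∣) (sym (+-comm n 1))) (∣m-m+n∣≡n n 1)

∣1+n-n∣≡1 : ∀ n → ∣ suc n - n ∣ ≡ 1
∣1+n-n∣≡1 n = trans (∣-∣-comm (suc n) n) (∣n-1+n∣≡1 n)

interval : ℕ → ℕ → List ℕ
interval j zero = []
interval j (suc k) = j ∷ interval (suc j) k

interval-++ : ∀ j a b → interval j (a + b) ≡ interval j a ++ interval (j + a) b
interval-++ j zero b = cong (λ z → interval z b) (sym (+-identityʳ j))
interval-++ j (suc a) b = cong (j ∷_) (trans (interval-++ (suc j) a b) (cong (λ z → interval (suc j) a ++ interval z b) (sym (+-suc j a))))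

interval-snoc : ∀ j k → interval j (suc k) ≡ interval j k ++ (k + j) ∷ []
interval-snoc j zero = refl
interval-snoc j (suc k) = cong (j ∷_) (trans (interval-snoc (suc j) k) (cong (λ z → interval (suc j) k ++ z ∷ []) (+-suc k j)))

map-interval : ∀ d j k → map (d +_) (interval j k) ≡ interval (d + j) k
map-interval d j zero = refl
map-interval d j (suc k) = cong ((d + j) ∷_) (trans (map-interval d (suc j) k) (cong (λ z → interval z k) (+-suc d j)))

map-interval′ : ∀ d j k → map (_+ d) (interval j k) ≡ interval (j + d) k
map-interval′ d j zero = refl
map-interval′ d j (suc k) = cong ((j + d) ∷_) (map-interval′ d (suc j) k)

upTo≡interval : ∀ n → upTo n ≡ interval 0 n
upTo≡interval n = go n (λ i → i) 0 (λ i → refl)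
  where
  go : ∀ n (f : ℕ → ℕ) j → (∀ i → f i ≡ j + i) → applyUpTo f n ≡ interval j n
  go zero f j h = refl
  go (suc n) f j h = cong₂ _∷_ (trans (h 0) (+-identityʳ j))
    (go n (λ i → f (suc i)) (suc j) (λ i → trans (h (suc i)) (+-suc j i)))

interval-walk : ∀ j k → Walk j (interval (suc j) k) (j + k) (replicate k 1)
interval-walk j zero = ↭-refl , sym (+-identityʳ j)
interval-walk j (suc k) with interval-walk (suc j) k
... | p , q = ∷⁺↭ (∣n-1+n∣≡1 j) p , trans q (sym (+-suc j k))

++-interchange : ∀ (A B A' B' : List ℕ) → (A ++ B) ++ (A' ++ B') ↭ (A ++ A') ++ (B ++ B')
++-interchange A B A' B' = solve 4 (λ A B A' B' → (A ⊕ B) ⊕ (A' ⊕ B') ⊜ (A ⊕ A') ⊕ (B ⊕ B')) ↭-refl A B A' B'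

replicate-++ : ∀ a b (v : ℕ) → replicate a v ++ replicate b v ≡ replicate (a + b) v
replicate-++ zero b v = refl
replicate-++ (suc a) b v = cong (v ∷_) (replicate-++ a b v)

OnesAnd : ℕ → ℕ → ℕ → List ℕ
OnesAnd w k m = replicate k 1 ++ replicate m w

OnesAnd-++ : ∀ w k m k' m' → OnesAnd w k m ++ OnesAnd w k' m' ↭ OnesAnd w (k + k') (m + m')
OnesAnd-++ w k m k' m' = ↭-trans (++-interchange (replicate k 1) (replicate m w) (replicate k' 1) (replicate m' w))
  (↭-reflexive (cong₂ _++_ (replicate-++ k k' 1) (replicate-++ m m' w)))

OnesAnd-++₃ : ∀ w a b c d e f → OnesAnd w a b ++ (OnesAnd w c d ++ OnesAnd w e f) ↭ OnesAnd w (a + (c + e)) (b + (d + f))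
OnesAnd-++₃ w a b c d e f = ↭-trans (PP.++⁺ˡ (OnesAnd w a b) (OnesAnd-++ w c d e f)) (OnesAnd-++ w a b (c + e) (d + f))

OnesAnd-cong : ∀ {w k m k' m'} → k ≡ k' → m ≡ m' → OnesAnd w k m ↭ OnesAnd w k' m'
OnesAnd-cong refl refl = ↭-refl

module Jumps (x : ℕ) where
  L : ℕ → ℕ → ℕ → List ℕ
  L = L3 x

  L-++ : ∀ a b c a' b' c' → L a b c ++ L a' b' c' ↭ L (a + a') (b + b') (c + c')
  L-++ a b c a' b' c' =
    ↭-trans (++-interchange (replicate a 1) (replicate b x ++ replicate c (suc x)) (replicate a' 1) (replicate b' x ++ replicate c' (suc x)))
    (↭-trans (PP.++⁺ˡ (replicate a 1 ++ replicate a' 1) (++-interchange (replicate b x) (replicate c (suc x)) (replicate b' x) (replicate c' (suc x))))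
    (↭-reflexive (cong₂ _++_ (replicate-++ a a' 1) (cong₂ _++_ (replicate-++ b b' x) (replicate-++ c c' (suc x))))))

  L-cong : ∀ {a b c a' b' c'} → a ≡ a' → b ≡ b' → c ≡ c' → L a b c ↭ L a' b' c'
  L-cong refl refl refl = ↭-refl

  L-cong′ : ∀ a b c a' b' c' → a ≡ a' → b ≡ b' → c ≡ c' → L a b c ↭ L a' b' c'
  L-cong′ a b c a' b' c' refl refl refl = ↭-refl

  OnesAnd≡L : ∀ k m → OnesAnd x k m ≡ L k m 0
  OnesAnd≡L k m = cong (replicate k 1 ++_) (sym (LP.++-identityʳ (replicate m x)))

peak : ℕ → ℕ → ℕ → ℕ
peak j w zero = j
peak j w (suc g) = peak (j + w) w g

ascent : ℕ → ℕ → ℕ → List ℕ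
ascent j w zero = []
ascent j w (suc g) = (j + w) ∷ ascent (j + w) w g

column : ℕ → ℕ → ℕ → List ℕ
column j w g = j ∷ ascent j w g

descent : ℕ → ℕ → ℕ → List ℕ
descent j w zero = []
descent j w (suc g) = descent (j + w) w g ++ (j ∷ [])

columnDown : ℕ → ℕ → ℕ → List ℕ
columnDown j w g = peak j w g ∷ descent j w g

peak-suc : ∀ j w g → peak (suc j) w g ≡ suc (peak j w g)
peak-suc j w zero = refl
peak-suc j w (suc g) = peak-suc (j + w) w g

peak-+ : ∀ j d w g → peak (j + d) w g ≡ peak j w g + d
peak-+ j d w zero = refl
peak-+ j d w (suc g) =
  trans (cong (λ z → peak z w g) (trans (+-assoc j d w) (trans (cong (j +_) (+-comm d w)) (sym (+-assoc j w d)))))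
        (peak-+ (j + w) d w g)

ascent-walk : ∀ j w g → Walk j (ascent j w g) (peak j w g) (replicate g w)
ascent-walk j w zero = ↭-refl , refl
ascent-walk j w (suc g) with ascent-walk (j + w) w g
... | p , q = ∷⁺↭ (∣m-m+n∣≡n j w) p , q

column-walk : ∀ e j w g → Walk e (column j w g) (peak j w g) (∣ e - j ∣ ∷ replicate g w)
column-walk e j w g with ascent-walk j w g
... | p , q = prep _ p , q

columnDown-walk : ∀ e j w g → Walk e (columnDown j w g) j (∣ e - peak j w g ∣ ∷ replicate g w)
columnDown-walk e j w zero = ↭-refl , refl
columnDown-walk e j w (suc g) =
  walk-↭ (walk-++ (columnDown-walk e (j + w) w g) ((∷⁺↭ (∣m+n-m∣≡n j w) ↭-refl) , refl))
        (prep _ (↭-sym (PP.∷↭∷ʳ w (replicate g w))))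

column-walk₁ : ∀ e j w g → ∣ e - j ∣ ≡ 1 → Walk e (column j w g) (peak j w g) (OnesAnd w 1 g)
column-walk₁ e j w g h = walk-↭ (column-walk e j w g) (∷⁺↭ h ↭-refl)

columnDown-walk₁ : ∀ e j w g → ∣ e - peak j w g ∣ ≡ 1 → Walk e (columnDown j w g) j (OnesAnd w 1 g)
columnDown-walk₁ e j w g h = walk-↭ (columnDown-walk e j w g) (∷⁺↭ h ↭-refl)

ascent-shift : ∀ j w g → ascent (j + w) w g ≡ map (_+ w) (ascent j w g)
ascent-shift j w zero = refl
ascent-shift j w (suc g) = cong ((j + w + w) ∷_) (ascent-shift (j + w) w g)

column-shift : ∀ j w g → column (j + w) w g ≡ map (_+ w) (column j w g)
column-shift j w g = cong ((j + w) ∷_) (ascent-shift j w g)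

columnDown↭column : ∀ j w g → columnDown j w g ↭ column j w g
columnDown↭column j w zero = ↭-refl
columnDown↭column j w (suc g) = ↭-trans (PP.++⁺ʳ (j ∷ []) (columnDown↭column (j + w) w g)) (↭-sym (PP.∷↭∷ʳ j (column (j + w) w g)))

-- Grids.  columns w g j k are the k adjacent columns of height g over
-- j, …, j+k-1.  Columns of step w whose bases fill the interval [0, w) form
-- an interval: k1 columns of height g+1 followed by k2 = w - k1 of height g
-- cover exactly [0, gridSize w k1 g).

columns : ℕ → ℕ → ℕ → ℕ → List ℕ
columns w g j zero = []
columns w g j (suc k) = columns w g j k ++ column (k + j) w g

columns-flat : ∀ w j k → columns w 0 j k ≡ interval j k
columns-flat w j zero = refl
columns-flat w j (suc k) = trans (cong (_++ (k + j) ∷ []) (columns-flat w j k)) (sym (interval-snoc j k))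

columns-suc : ∀ w g j k → columns w (suc g) j k ↭ interval j k ++ map (_+ w) (columns w g j k)
columns-suc w g j zero = ↭-refl
columns-suc w g j (suc k) =
  ↭-trans (PP.++⁺ʳ (column (k + j) w (suc g)) (columns-suc w g j k))
  (↭-trans (↭-reflexive (cong (λ z → (interval j k ++ map (_+ w) (columns w g j k)) ++ (k + j) ∷ z) (column-shift (k + j) w g)))
  (↭-trans (++-interchange (interval j k) (map (_+ w) (columns w g j k)) ((k + j) ∷ []) (map (_+ w) (column (k + j) w g)))
  (↭-reflexive (cong₂ _++_ (sym (interval-snoc j k)) (sym (LP.map-++ (_+ w) (columns w g j k) (column (k + j) w g)))))))

gridSize : ℕ → ℕ → ℕ → ℕ
gridSize w k1 zero = w + k1
gridSize w k1 (suc g) = w + gridSize w k1 g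

columns-grid : ∀ w g k1 k2 → w ≡ k1 + k2 → columns w (suc g) 0 k1 ++ columns w g k1 k2 ↭ interval 0 (gridSize w k1 g)
columns-grid w zero k1 k2 eq =
  ↭-trans (PP.++⁺ (columns-suc w 0 0 k1) (↭-reflexive (columns-flat w k1 k2)))
  (↭-trans (↭-reflexive (cong (λ z → (interval 0 k1 ++ z) ++ interval k1 k2) (trans (cong (map (_+ w)) (columns-flat w 0 k1)) (map-interval′ w 0 k1))))
  (↭-trans (solve 3 (λ A B C → (A ⊕ B) ⊕ C ⊜ (A ⊕ C) ⊕ B) ↭-refl (interval 0 k1) (interval w k1) (interval k1 k2))
  (↭-reflexive (trans (cong₂ _++_ (sym (interval-++ 0 k1 k2)) refl)
               (trans (cong (λ z → interval 0 z ++ interval w k1) (sym eq)) (sym (interval-++ 0 w k1)))))))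
columns-grid w (suc g) k1 k2 eq =
  ↭-trans (PP.++⁺ (columns-suc w (suc g) 0 k1) (columns-suc w g k1 k2))
  (↭-trans (++-interchange (interval 0 k1) (map (_+ w) (columns w (suc g) 0 k1)) (interval k1 k2) (map (_+ w) (columns w g k1 k2)))
  (↭-trans (PP.++⁺ (↭-reflexive (sym (interval-++ 0 k1 k2)))
             (↭-trans (↭-reflexive (sym (LP.map-++ (_+ w) (columns w (suc g) 0 k1) (columns w g k1 k2))))
                      (PP.map⁺ (_+ w) (columns-grid w g k1 k2 eq))))
  (↭-reflexive (trans (cong₂ _++_ (cong (interval 0) (sym eq)) (map-interval′ w 0 (gridSize w k1 g))) (sym (interval-++ 0 w (gridSize w k1 g)))))))

-- A snake crosses 2u adjacent columns of equal height, climbing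
-- one column and descending the next, joined by unit steps.  There are
-- four variants: moving right (rise) or left (fall), and starting at the
-- bottom (UD: up first) or at the top (DU: down first).

double : ℕ → ℕ
double zero = zero
double (suc u) = suc (suc (double u))

snakeEnd : ℕ → ℕ → ℕ
snakeEnd t zero = t
snakeEnd t (suc u) = suc (double u + suc t)

snakeEnd-suc : ∀ t u → suc (snakeEnd t u) ≡ double u + suc t
snakeEnd-suc t zero = refl
snakeEnd-suc t (suc u) = refl

OnesAnd-snoc-pair : ∀ w d g → OnesAnd w d (d * g) ++ (OnesAnd w 1 g ++ OnesAnd w 1 g) ↭ OnesAnd w (suc (suc d)) (suc (suc d) * g)
OnesAnd-snoc-pair w d g = ↭-trans (OnesAnd-++₃ w d (d * g) 1 g 1 g) (OnesAnd-cong (ones d) (jumps d g))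
  where
  ones : ∀ d → d + (1 + 1) ≡ suc (suc d)
  ones = solve-∀
  jumps : ∀ d g → d * g + (g + g) ≡ g + (g + d * g)
  jumps = solve-∀

riseUD : ℕ → ℕ → ℕ → ℕ → List ℕ
riseUD w g t zero = []
riseUD w g t (suc u) = riseUD w g t u ++ (column (double u + suc t) w g ++ columnDown (suc (double u + suc t)) w g)

riseUD-walk : ∀ w g t u → Walk t (riseUD w g t u) (snakeEnd t u) (OnesAnd w (double u) (double u * g))
riseUD-walk w g t zero = walk-[] t
riseUD-walk w g t (suc u) =
  walk-↭ (walk-++ (riseUD-walk w g t u)
          (walk-++ (column-walk₁ (snakeEnd t u) K w g (trans (cong (λ z → ∣ snakeEnd t u - z ∣) (sym (snakeEnd-suc t u))) (∣n-1+n∣≡1 (snakeEnd t u))))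
                 (columnDown-walk₁ (peak K w g) (suc K) w g (trans (cong (λ z → ∣ peak K w g - z ∣) (peak-suc K w g)) (∣n-1+n∣≡1 (peak K w g))))))
        (OnesAnd-snoc-pair w (double u) g)
  where K = double u + suc t

riseDU : ℕ → ℕ → ℕ → ℕ → List ℕ
riseDU w g t zero = []
riseDU w g t (suc u) = riseDU w g t u ++ (columnDown (double u + suc t) w g ++ column (suc (double u + suc t)) w g)

riseDU-walk : ∀ w g t u → Walk (peak t w g) (riseDU w g t u) (peak (snakeEnd t u) w g) (OnesAnd w (double u) (double u * g))
riseDU-walk w g t zero = walk-[] _
riseDU-walk w g t (suc u) =
  walk-↭ (walk-++ (riseDU-walk w g t u)
          (walk-++ (columnDown-walk₁ (peak (snakeEnd t u) w g) K w g
                   (trans (cong (λ z → ∣ peak (snakeEnd t u) w g - peak z w g ∣) (sym (snakeEnd-suc t u)))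
                     (trans (cong (λ z → ∣ peak (snakeEnd t u) w g - z ∣) (peak-suc (snakeEnd t u) w g)) (∣n-1+n∣≡1 (peak (snakeEnd t u) w g)))))
                 (column-walk₁ K (suc K) w g (∣n-1+n∣≡1 K))))
        (OnesAnd-snoc-pair w (double u) g)
  where K = double u + suc t

fallUD : ℕ → ℕ → ℕ → ℕ → List ℕ
fallUD w g j zero = []
fallUD w g j (suc u) = column (suc (double u + j)) w g ++ (columnDown (double u + j) w g ++ fallUD w g j u)

fallUD-walk : ∀ w g j u → Walk (double u + j) (fallUD w g j u) j (OnesAnd w (double u) (double u * g))
fallUD-walk w g j zero = walk-[] j
fallUD-walk w g j (suc u) =
  walk-↭ (walk-++ (column-walk₁ (suc (suc K)) (suc K) w g (∣1+n-n∣≡1 (suc K)))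
          (walk-++ (columnDown-walk₁ (peak (suc K) w g) K w g (trans (cong (λ z → ∣ z - peak K w g ∣) (peak-suc K w g)) (∣1+n-n∣≡1 (peak K w g))))
                 (fallUD-walk w g j u)))
        (OnesAnd-++₃ w 1 g 1 g (double u) (double u * g))
  where K = double u + j

fallDU : ℕ → ℕ → ℕ → ℕ → List ℕ
fallDU w g j zero = []
fallDU w g j (suc u) = columnDown (suc (double u + j)) w g ++ (column (double u + j) w g ++ fallDU w g j u)

fallDU-walk : ∀ w g j u → Walk (peak (double u + j) w g) (fallDU w g j u) (peak j w g) (OnesAnd w (double u) (double u * g))
fallDU-walk w g j zero = walk-[] _
fallDU-walk w g j (suc u) =
  walk-↭ (walk-++ (columnDown-walk₁ (peak (suc (suc K)) w g) (suc K) w g (trans (cong (λ z → ∣ z - peak (suc K) w g ∣) (peak-suc (suc K) w g)) (∣1+n-n∣≡1 (peak (suc K) w g))))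
          (walk-++ (column-walk₁ (suc K) K w g (∣1+n-n∣≡1 K))
                 (fallDU-walk w g j u)))
        (OnesAnd-++₃ w 1 g 1 g (double u) (double u * g))
  where K = double u + j

++-rotate : ∀ (A B C : List ℕ) → A ++ (B ++ C) ↭ (C ++ B) ++ A
++-rotate A B C = ↭-trans (PP.++-comm A (B ++ C)) (PP.++⁺ʳ A (PP.++-comm B C))

riseUD↭ : ∀ w g t u → riseUD w g t u ↭ columns w g (suc t) (double u)
riseUD↭ w g t zero = ↭-refl
riseUD↭ w g t (suc u) =
  ↭-trans (PP.++⁺ (riseUD↭ w g t u) (PP.++⁺ˡ (column (double u + suc t) w g) (columnDown↭column _ w g)))
  (↭-reflexive (sym (LP.++-assoc (columns w g (suc t) (double u)) _ _)))

riseDU↭ : ∀ w g t u → riseDU w g t u ↭ columns w g (suc t) (double u)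
riseDU↭ w g t zero = ↭-refl
riseDU↭ w g t (suc u) =
  ↭-trans (PP.++⁺ (riseDU↭ w g t u) (PP.++⁺ʳ (column (suc (double u + suc t)) w g) (columnDown↭column _ w g)))
  (↭-reflexive (sym (LP.++-assoc (columns w g (suc t) (double u)) _ _)))

fallUD↭ : ∀ w g j u → fallUD w g j u ↭ columns w g j (double u)
fallUD↭ w g j zero = ↭-refl
fallUD↭ w g j (suc u) =
  ↭-trans (PP.++⁺ˡ (column (suc (double u + j)) w g) (PP.++⁺ (columnDown↭column _ w g) (fallUD↭ w g j u)))
  (↭-trans (++-rotate (column (suc (double u + j)) w g) (column (double u + j) w g) (columns w g j (double u))) ↭-refl)

fallDU↭ : ∀ w g j u → fallDU w g j u ↭ columns w g j (double u)
fallDU↭ w g j zero = ↭-refl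
fallDU↭ w g j (suc u) =
  ↭-trans (PP.++⁺ (columnDown↭column _ w g) (PP.++⁺ˡ (column (double u + j) w g) (fallDU↭ w g j u)))
  (++-rotate (column (suc (double u + j)) w g) (column (double u + j) w g) (columns w g j (double u)))

countdown : ℕ → ℕ → List ℕ
countdown j zero = []
countdown j (suc k) = (k + j) ∷ countdown j k

countdown-walk : ∀ j k → Walk (k + j) (countdown j k) j (replicate k 1)
countdown-walk j zero = walk-[] j
countdown-walk j (suc k) with countdown-walk j k
... | p , q = ∷⁺↭ (∣1+n-n∣≡1 (k + j)) p , q

countdown↭ : ∀ j k → countdown j k ↭ interval j k
countdown↭ j zero = ↭-refl
countdown↭ j (suc k) = ↭-trans (prep (k + j) (countdown↭ j k))
  (↭-trans (PP.∷↭∷ʳ (k + j) (interval j k)) (↭-reflexive (sym (interval-snoc j k))))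

snakeEnd≡ : ∀ t u → snakeEnd t u ≡ double u + t
snakeEnd≡ t zero = refl
snakeEnd≡ t (suc u) = cong suc (+-suc (double u) t)

peak-0 : ∀ w g → peak 0 w g ≡ g * w
peak-0 w zero = refl
peak-0 w (suc g) = trans (peak-+ 0 w w g) (trans (cong (_+ w) (peak-0 w g)) (+-comm (g * w) w))

peak≡ : ∀ j w g → peak j w g ≡ g * w + j
peak≡ j w g = trans (peak-+ 0 j w g) (cong (_+ j) (peak-0 w g))

double≡ : ∀ u → double u ≡ u + u
double≡ zero = refl
double≡ (suc u) = cong suc (trans (cong suc (double≡ u)) (sym (+-suc u u)))

gridSize≡ : ∀ w k1 g → gridSize w k1 g ≡ suc g * w + k1
gridSize≡ w k1 zero = cong (λ z → z + k1) (sym (+-identityʳ w))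
gridSize≡ w k1 (suc g) = trans (cong (w +_) (gridSize≡ w k1 g)) (sym (+-assoc w (suc g * w) k1))

columns-cons : ∀ w g j k → columns w g j (suc k) ≡ column j w g ++ columns w g (suc j) k
columns-cons w g j zero = sym (LP.++-identityʳ (column j w g))
columns-cons w g j (suc k) =
  trans (cong (_++ column (suc k + j) w g) (columns-cons w g j k))
  (trans (LP.++-assoc (column j w g) (columns w g (suc j) k) (column (suc k + j) w g))
   (cong (λ z → column j w g ++ (columns w g (suc j) k ++ column z w g)) (sym (+-suc k j))))

columns-++ : ∀ w g j a b → columns w g j a ++ columns w g (a + j) b ≡ columns w g j (b + a)
columns-++ w g j a zero = LP.++-identityʳ (columns w g j a)
columns-++ w g j a (suc b) =
  trans (sym (LP.++-assoc (columns w g j a) (columns w g (a + j) b) (column (b + (a + j)) w g)))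
  (cong₂ _++_ (columns-++ w g j a b) (cong (λ z → column z w g) (sym (+-assoc b a j))))

++-assoc₄ : ∀ (X A B C : List ℕ) → X ++ (A ++ (B ++ C)) ≡ ((X ++ A) ++ B) ++ C
++-assoc₄ X A B C = trans (sym (LP.++-assoc X A (B ++ C))) (sym (LP.++-assoc (X ++ A) B C))

columns-ends : ∀ w g k → columns w g 0 (suc (suc k)) ≡ (column 0 w g ++ columns w g 1 k) ++ column (suc k) w g
columns-ends w g k = cong₂ _++_ (columns-cons w g 0 k) (cong (λ z → column z w g) (+-identityʳ (suc k)))

-- A perfect realization can be followed by any realization translated
-- by N, which is how all realizations below are assembled.

record Realization (N : ℕ) (M : List ℕ) : Set where
  constructor realization
  field
    rs : List ℕ
    covers : 0 ∷ rs ↭ interval 0 (suc N)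
    end : ℕ
    walk : Walk 0 rs end M

record Perfect (N : ℕ) (M : List ℕ) : Set where
  constructor perfect
  field
    rs : List ℕ
    covers : 0 ∷ rs ↭ interval 0 (suc N)
    walk : Walk 0 rs N M

realize : ∀ {rs K N t M} → 0 ∷ rs ↭ K → K ↭ interval 0 (suc N) → Walk 0 rs t M → Realization N M
realize c1 c2 p = realization _ (↭-trans c1 c2) _ p

realization-↭ : ∀ {N M M'} → Realization N M → M ↭ M' → Realization N M'
realization-↭ (realization rs c t p) q = realization rs c t (walk-↭ p q)

realization-size : ∀ {N N' M} → Realization N M → N ≡ N' → Realization N' M
realization-size r refl = r

perfect-↭ : ∀ {N M M'} → Perfect N M → M ↭ M' → Perfect N M'
perfect-↭ (perfect rs c p) q = perfect rs c (walk-↭ p q)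

diffsFrom-shift : ∀ d e xs → diffsFrom (d + e) (map (d +_) xs) ≡ diffsFrom e xs
diffsFrom-shift d e [] = refl
diffsFrom-shift d e (v ∷ xs) = cong₂ _∷_ (∣m+n-m+o∣≡∣n-o∣ d e v) (diffsFrom-shift d v xs)

lastFrom-shift : ∀ d e xs → lastFrom (d + e) (map (d +_) xs) ≡ d + lastFrom e xs
lastFrom-shift d e [] = refl
lastFrom-shift d e (v ∷ xs) = lastFrom-shift d v xs

walk-shift : ∀ d {xs t M} → Walk 0 xs t M → Walk d (map (d +_) xs) (d + t) M
walk-shift d {xs} (p , q) = walk-start (subst (λ z → z ↭ _) (sym (diffsFrom-shift d 0 xs)) p , trans (lastFrom-shift d 0 xs) (cong (d +_) q)) (+-identityʳ d)

covers-append : ∀ N1 N2 rs1 rs2 → 0 ∷ rs1 ↭ interval 0 (suc N1) → 0 ∷ rs2 ↭ interval 0 (suc N2) →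
           0 ∷ (rs1 ++ map (N1 +_) rs2) ↭ interval 0 (suc (N1 + N2))
covers-append N1 N2 rs1 rs2 c1 c2 =
  ↭-trans (PP.++⁺ c1 (PP.map⁺ (N1 +_) (PP.drop-∷ c2)))
  (↭-reflexive (trans (cong (interval 0 (suc N1) ++_) (trans (map-interval N1 1 N2) (cong (λ z → interval z N2) (+-comm N1 1))))
     (sym (interval-++ 0 (suc N1) N2))))

perfect⊕realization : ∀ {N1 M1 N2 M2} → Perfect N1 M1 → Realization N2 M2 → Realization (N1 + N2) (M1 ++ M2)
perfect⊕realization {N1} {M1} {N2} (perfect rs1 c1 p1) (realization rs2 c2 t2 p2) =
  realization (rs1 ++ map (N1 +_) rs2) (covers-append N1 N2 rs1 rs2 c1 c2) _ (walk-++ p1 (walk-shift N1 p2))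

perfect⊕perfect : ∀ {N1 M1 N2 M2} → Perfect N1 M1 → Perfect N2 M2 → Perfect (N1 + N2) (M1 ++ M2)
perfect⊕perfect {N1} {M1} {N2} (perfect rs1 c1 p1) (perfect rs2 c2 p2) =
  perfect (rs1 ++ map (N1 +_) rs2) (covers-append N1 N2 rs1 rs2 c1 c2) (walk-++ p1 (walk-shift N1 p2))

onesPerfect : ∀ k → Perfect k (replicate k 1)
onesPerfect k = perfect (interval 1 k) ↭-refl (interval-walk 0 k)

standardRealization : ∀ x a b c → Realization (a + b + c) (L3 x a b c) → Σ (List ℕ) (λ xs → IsStandardLinearRealization (L3 x a b c) xs)
standardRealization x a b c (realization rs cv t (p , q)) =
  (0 ∷ rs) ,
  ((↭-trans cv (↭-reflexive (trans (cong (λ z → interval 0 (suc z)) (sym lenL)) (sym (upTo≡interval _)))) ,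
   subst (λ z → z ↭ L3 x a b c) (sym (consecutiveDiffs≡diffsFrom 0 rs)) p) ,
  refl)
  where
  lenL : length (L3 x a b c) ≡ a + b + c
  lenL = trans (LP.length-++ (replicate a 1))
         (trans (cong₂ _+_ (LP.length-replicate a) (trans (LP.length-++ (replicate b x)) (cong₂ _+_ (LP.length-replicate b) (LP.length-replicate c))))
         (sym (+-assoc a b c)))

≤⇒∃+ : ∀ {a b} → a ≤ b → Σ ℕ λ s → b ≡ a + s
≤⇒∃+ {zero} {b} z≤n = b , refl
≤⇒∃+ (s≤s h) with ≤⇒∃+ h
... | s , e = s , cong suc e

parity : ∀ m → Σ ℕ λ p → (m ≡ double p) ⊎ (m ≡ suc (double p))
parity zero = 0 , inj₁ refl
parity (suc m) with parity m
... | p , inj₁ e = p , inj₂ (cong suc e)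
... | p , inj₂ e = suc p , inj₁ (cong suc e)

double-+ : ∀ a b → double (a + b) ≡ double a + double b
double-+ zero b = refl
double-+ (suc a) b = cong (λ z → suc (suc z)) (double-+ a b)

double≤1+double⇒≤ : ∀ p n → double p ≤ suc (double n) → p ≤ n
double≤1+double⇒≤ zero n h = z≤n
double≤1+double⇒≤ (suc p) zero (s≤s ())
double≤1+double⇒≤ (suc p) (suc n) h = s≤s (double≤1+double⇒≤ p n (≤-pred (≤-pred h)))

double-≤⇒≤ : ∀ p n → double p ≤ double n → p ≤ n
double-≤⇒≤ zero n h = z≤n
double-≤⇒≤ (suc p) zero ()
double-≤⇒≤ (suc p) (suc n) h = s≤s (double-≤⇒≤ p n (≤-pred (≤-pred h)))

-- Used to rule out a zero quotient.
c+[1+a+b]≢a : ∀ c a b → c + suc (a + b) ≡ a → ⊥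
c+[1+a+b]≢a c a b e = <-irrefl refl (subst (a <_) e (≤-trans (s≤s (m≤m+n a b)) (m≤n+m (suc (a + b)) c)))

≤-by : ∀ {a b} d → b ≡ a + d → a ≤ b
≤-by {a} d refl = m≤m+n a d

double%2≡0 : ∀ p → double p % 2 ≡ 0
double%2≡0 zero = refl
double%2≡0 (suc p) = trans (cong (_% 2) (+-comm 2 (double p))) (trans ([m+n]%n≡m%n (double p) 2) (double%2≡0 p))

odd≥3 : ∀ x → x ≥ 3 → x % 2 ≡ 1 → Σ ℕ λ n' → x ≡ suc (double (suc n'))
odd≥3 x x≥3 odd with parity x
... | p , inj₁ refl = ⊥-elim (0≢1+n (trans (sym (double%2≡0 p)) odd))
... | zero , inj₂ refl = ⊥-elim (≤⇒≯ x≥3 (s≤s (s≤s z≤n)))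
... | suc n' , inj₂ refl = n' , refl

module Blocks (n : ℕ) where
  x : ℕ
  x = suc (double n)
  y : ℕ
  y = suc x
  open Jumps x

  -- The x-snake: [0, (m+1)x - 1] as x columns of step x and height m,
  -- climbed first and then crossed by a down-up snake; a perfect
  -- realization of {1^(x-1), x^(m x)}.
  xSnake : ∀ m → Perfect (m * x + double n) (L (double n) (x * m) 0)
  xSnake m = perfect (ascent 0 x m ++ riseDU x m 0 n)
    (↭-trans (PP.++⁺ˡ (column 0 x m) (riseDU↭ x m 0 n))
      (↭-trans (↭-reflexive (sym (columns-cons x m 0 (double n))))
      (↭-trans (columns-grid x m 0 x refl) (↭-reflexive (cong (interval 0) eqN)))))
    (walk-end (walk-↭ (walk-++ (ascent-walk 0 x m) (riseDU-walk x m 0 n))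
                 (↭-trans (OnesAnd-++ x 0 m (double n) (double n * m)) (↭-reflexive (OnesAnd≡L (double n) (m + double n * m)))))
          (trans (peak≡ (snakeEnd 0 n) x m) (cong (m * x +_) (trans (snakeEnd≡ 0 n) (+-identityʳ (double n))))))
    where
    eqN : gridSize x 0 m ≡ suc (m * x + double n)
    eqN = trans (gridSize≡ x 0 m) (trans (+-identityʳ (suc m * x)) (trans (+-comm x (m * x)) (+-suc (m * x) (double n))))

  -- y-snakes.  [0, x+c] forms y columns of step y over the bases 0, …, x;
  -- writing c + x = Q·y + ρ, the first ρ+1 columns have height Q and the
  -- others height Q-1.  A snake through all of them uses {1^x, y^c}; making
  -- one link an x-jump between column tops of different height instead
  -- uses {1^(x-1), x, y^c}.  The shape of the snake depends on the parity
  -- of ρ.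

  -- Climb column 0, snake right over the tall columns and then the short
  -- ones (ρ odd).
  ySnakeForward : ∀ p s q G → Σ (List ℕ) λ rs →
           (0 ∷ rs ↭ columns y G 0 (double (suc p)) ++ columns y q (double (suc p)) (double s)) ×
           Walk 0 rs (snakeEnd (suc (double p)) s) (L (double p + suc (double s)) 0 (G + (double p * G + (G + double s * q))))
  ySnakeForward p s q G =
    (ascent 0 y G ++ (riseDU y G 0 p ++ (columnDown (suc (double p)) y G ++ riseUD y q (suc (double p)) s))) ,
    ↭-trans (PP.++⁺ˡ (column 0 y G) (PP.++⁺ (riseDU↭ y G 0 p) (PP.++⁺ (columnDown↭column (suc (double p)) y G) (riseUD↭ y q (suc (double p)) s))))
      (↭-reflexive (trans (++-assoc₄ (column 0 y G) (columns y G 1 (double p)) (column (suc (double p)) y G) (columns y q (suc (suc (double p))) (double s)))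
                          (cong (_++ columns y q (suc (suc (double p))) (double s)) (sym (columns-ends y G (double p)))))) ,
    walk-↭ (walk-++ (ascent-walk 0 y G) (walk-++ (riseDU-walk y G 0 p)
            (walk-++ (columnDown-walk₁ _ (suc (double p)) y G lk) (riseUD-walk y q (suc (double p)) s))))
          (↭-trans (PP.++⁺ˡ (replicate G y) (OnesAnd-++₃ y (double p) (double p * G) 1 G (double s) (double s * q)))
                   (OnesAnd-++ y 0 G (double p + (1 + double s)) (double p * G + (G + double s * q))))
    where
    ue0 : snakeEnd 0 p ≡ double p
    ue0 = trans (snakeEnd≡ 0 p) (+-identityʳ (double p))
    lk : ∣ peak (snakeEnd 0 p) y G - peak (suc (double p)) y G ∣ ≡ 1
    lk = trans (cong₂ (λ u v → ∣ peak u y G - v ∣) ue0 (peak-suc (double p) y G)) (∣n-1+n∣≡1 (peak (double p) y G))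

  -- Climb column 0, step to the top of the last column and snake left
  -- back to column 1 (ρ even).
  ySnakeBackward : ∀ p s q → x ≡ double s + suc (double p) → Σ (List ℕ) λ rs →
           (0 ∷ rs ↭ columns y (suc q) 0 (suc (double p)) ++ columns y q (suc (double p)) (suc (double s))) ×
           Walk 0 rs 1 (L (suc (double s + double p)) 0 (suc q + (q + (double s * q + double p * suc q))))
  ySnakeBackward p s q eqx =
    (ascent 0 y (suc q) ++ (columnDown x y q ++ (fallUD y q (suc (double p)) s ++ fallUD y (suc q) 1 p))) ,
    ↭-trans (PP.++⁺ˡ (column 0 y (suc q)) (PP.++⁺ (columnDown↭column x y q) (PP.++⁺ (fallUD↭ y q (suc (double p)) s) (fallUD↭ y (suc q) 1 p))))
      (↭-trans (solve 4 (λ X B S T → X ⊕ (B ⊕ (S ⊕ T)) ⊜ (X ⊕ T) ⊕ (S ⊕ B)) ↭-refl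
                   (column 0 y (suc q)) (column x y q) (columns y q (suc (double p)) (double s)) (columns y (suc q) 1 (double p)))
        (↭-reflexive (cong₂ _++_ (sym (columns-cons y (suc q) 0 (double p)))
                      (cong (λ z → columns y q (suc (double p)) (double s) ++ column z y q) eqx)))) ,
    walk-↭ (walk-++ (ascent-walk 0 y (suc q)) (walk-++ (columnDown-walk₁ _ x y q lk1)
            (walk-++ (walk-start (fallUD-walk y q (suc (double p)) s) (sym eqx))
                   (walk-start (fallUD-walk y (suc q) 1 p) (+-comm (double p) 1)))))
          (↭-trans (PP.++⁺ˡ (replicate (suc q) y) (OnesAnd-++₃ y 1 q (double s) (double s * q) (double p) (double p * suc q)))
                   (OnesAnd-++ y 0 (suc q) (1 + (double s + double p)) (q + (double s * q + double p * suc q))))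
    where
    lk1 : ∣ peak 0 y (suc q) - peak x y q ∣ ≡ 1
    lk1 = trans (cong₂ (λ u v → ∣ u - v ∣) (peak-+ 0 y y q) (peak-+ 0 x y q))
          (trans (cong (λ z → ∣ z - (peak 0 y q + x) ∣) (+-suc (peak 0 y q) x)) (∣1+n-n∣≡1 (peak 0 y q + x)))

  -- As ySnakeForward, but the link from the last tall column down to the
  -- first short one is an x-jump (ρ even).
  xySnakeForward : ∀ p s q → Σ (List ℕ) λ rs →
           (0 ∷ rs ↭ columns y (suc q) 0 (suc (double p)) ++ columns y q (suc (double p)) (suc (double s))) ×
           Σ ℕ λ t → Walk 0 rs t (L (double p + double s) 1 (suc q + (double p * suc q + (q + double s * q))))
  xySnakeForward p s q =
    (ascent 0 y (suc q) ++ (riseDU y (suc q) 0 p ++ (columnDown (suc (double p)) y q ++ riseUD y q (suc (double p)) s))) ,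
    ↭-trans (PP.++⁺ˡ (column 0 y (suc q)) (PP.++⁺ (riseDU↭ y (suc q) 0 p) (PP.++⁺ (columnDown↭column (suc (double p)) y q) (riseUD↭ y q (suc (double p)) s))))
      (↭-reflexive (trans (sym (LP.++-assoc (column 0 y (suc q)) (columns y (suc q) 1 (double p)) _))
                    (cong₂ _++_ (sym (columns-cons y (suc q) 0 (double p))) (sym (columns-cons y q (suc (double p)) (double s)))))) ,
    _ ,
    walk-↭ (walk-++ (ascent-walk 0 y (suc q)) (walk-++ (riseDU-walk y (suc q) 0 p)
            (walk-++ (walk-↭ (columnDown-walk _ (suc (double p)) y q) (∷⁺↭ lk ↭-refl)) (riseUD-walk y q (suc (double p)) s))))
          (↭-trans (PP.++⁺ˡ (L 0 0 (suc q)) (↭-trans (PP.++⁺ˡ (L (double p) 0 (double p * suc q)) (L-++ 0 1 q (double s) 0 (double s * q)))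
                                                          (L-++ (double p) 0 (double p * suc q) (double s) 1 (q + double s * q))))
                   (L-++ 0 0 (suc q) (double p + double s) 1 (double p * suc q + (q + double s * q))))
    where
    top : ℕ
    top = peak (double p) y q
    lk : ∣ peak (snakeEnd 0 p) y (suc q) - peak (suc (double p)) y q ∣ ≡ x
    lk = trans (cong₂ (λ u v → ∣ u - v ∣)
                 (trans (cong (λ z → peak z y (suc q)) (trans (snakeEnd≡ 0 p) (+-identityʳ (double p)))) (peak-+ (double p) y y q))
                 (peak-suc (double p) y q))
         (trans (cong (λ z → ∣ z - suc top ∣) (+-suc top x)) (∣m+n-m∣≡n (suc top) x))

  -- As ySnakeBackward, snaking left over the short columns and then the
  -- tall ones, joined by an x-jump (ρ odd, ρ < x).
  xySnakeBackward : ∀ p s q → x ≡ double s + suc (suc (suc (double p))) → Σ (List ℕ) λ rs →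
           (0 ∷ rs ↭ columns y (suc q) 0 (double (suc p)) ++ columns y q (double (suc p)) (double (suc s))) ×
           Σ ℕ λ t → Walk 0 rs t (L (1 + (double s + (1 + double p))) 1 (suc q + (q + (double s * q + (q + (suc q + double p * suc q))))))
  xySnakeBackward p s q eqx =
    (ascent 0 y G ++ (columnDown x y q ++ (fallUD y q j3 s ++ (column j2 y q ++ (columnDown j1 y G ++ fallUD y G 1 p))))) ,
    ↭-trans (PP.++⁺ˡ (column 0 y G) (PP.++⁺ (columnDown↭column x y q) (PP.++⁺ (fallUD↭ y q j3 s)
              (PP.++⁺ˡ (column j2 y q) (PP.++⁺ (columnDown↭column j1 y G) (fallUD↭ y G 1 p))))))
      (↭-trans (solve 6 (λ X B S C2 C1 T → X ⊕ (B ⊕ (S ⊕ (C2 ⊕ (C1 ⊕ T)))) ⊜ ((X ⊕ T) ⊕ C1) ⊕ ((C2 ⊕ S) ⊕ B)) ↭-refl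
                  (column 0 y G) (column x y q) (columns y q j3 (double s)) (column j2 y q) (column j1 y G) (columns y G 1 (double p)))
      (↭-reflexive (cong₂ _++_ (sym (columns-ends y G (double p)))
          (cong₂ _++_ (sym (columns-cons y q j2 (double s))) (cong (λ z → column z y q) (trans eqx (+-suc (double s) j2))))))) ,
    _ ,
    walk-↭ (walk-++ (ascent-walk 0 y G) (walk-++ (columnDown-walk₁ _ x y q lk1) (walk-++ (walk-start (fallUD-walk y q j3 s) (sym eqx))
            (walk-++ (column-walk₁ j3 j2 y q (∣1+n-n∣≡1 j2)) (walk-++ (walk-↭ (columnDown-walk (peak j2 y q) j1 y G) (∷⁺↭ lk2 ↭-refl))
                   (walk-start (fallUD-walk y G 1 p) (+-comm (double p) 1)))))))
      (PP.++⁺ˡ (L 0 0 G) (PP.++⁺ˡ (L 1 0 q) (PP.++⁺ˡ (L (double s) 0 (double s * q)) (PP.++⁺ˡ (L 1 0 q)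
        (L-++ 0 1 G (double p) 0 (double p * G))))) ⟨↭⟩
       (PP.++⁺ˡ (L 0 0 G) (PP.++⁺ˡ (L 1 0 q) (PP.++⁺ˡ (L (double s) 0 (double s * q))
        (L-++ 1 0 q (double p) 1 (G + double p * G)))) ⟨↭⟩
       (PP.++⁺ˡ (L 0 0 G) (PP.++⁺ˡ (L 1 0 q) (L-++ (double s) 0 (double s * q) (1 + double p) 1 (q + (G + double p * G)))) ⟨↭⟩
       (PP.++⁺ˡ (L 0 0 G) (L-++ 1 0 q (double s + (1 + double p)) 1 (double s * q + (q + (G + double p * G)))) ⟨↭⟩
        L-++ 0 0 G (1 + (double s + (1 + double p))) 1 (q + (double s * q + (q + (G + double p * G))))))))
    where
    G = suc q
    j1 = suc (double p)
    j2 = suc j1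
    j3 = suc j2
    _⟨↭⟩_ : ∀ {A B C : List ℕ} → A ↭ B → B ↭ C → A ↭ C
    _⟨↭⟩_ = ↭-trans
    infixr 5 _⟨↭⟩_
    lk1 : ∣ peak 0 y (suc q) - peak x y q ∣ ≡ 1
    lk1 = trans (cong₂ (λ u v → ∣ u - v ∣) (peak-+ 0 y y q) (peak-+ 0 x y q))
          (trans (cong (λ z → ∣ z - (peak 0 y q + x) ∣) (+-suc (peak 0 y q) x)) (∣1+n-n∣≡1 (peak 0 y q + x)))
    lk2 : ∣ peak j2 y q - peak j1 y G ∣ ≡ x
    lk2 = trans (cong₂ (λ u v → ∣ u - v ∣) (peak-suc j1 y q) (peak-+ j1 y y q))
          (trans (cong (λ z → ∣ suc (peak j1 y q) - z ∣) (+-suc (peak j1 y q) x)) (∣m-m+n∣≡n (suc (peak j1 y q)) x))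

  -- All columns of equal height (ρ = x): climb column 0, x-jump to the top
  -- of the last column and snake left.
  xySnakeFull : ∀ G → Σ (List ℕ) λ rs → (0 ∷ rs ↭ columns y G 0 y) × Σ ℕ λ t → Walk 0 rs t (L (double n) 1 (y * G))
  xySnakeFull G =
    (ascent 0 y G ++ (columnDown x y G ++ fallUD y G 1 n)) ,
    ↭-trans (PP.++⁺ˡ (column 0 y G) (PP.++⁺ (columnDown↭column x y G) (fallUD↭ y G 1 n)))
      (↭-trans (solve 3 (λ X B T → X ⊕ (B ⊕ T) ⊜ (X ⊕ T) ⊕ B) ↭-refl (column 0 y G) (column x y G) (columns y G 1 (double n)))
        (↭-reflexive (sym (columns-ends y G (double n))))) ,
    _ ,
    walk-↭ (walk-++ (ascent-walk 0 y G) (walk-++ (walk-↭ (columnDown-walk (peak 0 y G) x y G) (∷⁺↭ lk ↭-refl))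
            (walk-start (fallUD-walk y G 1 n) (+-comm (double n) 1))))
      (↭-trans (PP.++⁺ˡ (L 0 0 G) (L-++ 0 1 G (double n) 0 (double n * G))) (L-++ 0 0 G (double n) 1 (G + double n * G)))
    where
    lk : ∣ peak 0 y G - peak x y G ∣ ≡ x
    lk = trans (cong (λ z → ∣ peak 0 y G - z ∣) (peak-+ 0 x y G)) (∣m-m+n∣≡n (peak 0 y G) x)

  divModY : ∀ N → Σ ℕ λ Q → Σ ℕ λ ρ → (ρ ≤ x) × (N ≡ Q * y + ρ)
  divModY N = N / y , N % y , ≤-pred (m%n<n N y) , trans (m≡m%n+[m/n]*n N y) (+-comm (N % y) _)

  -- {1^x, y^c} on [0, x+c], one case for each parity of ρ; the quotient
  -- Q = 0 cannot occur since c + x ≥ x > ρ.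
  yRealization-even : ∀ c Q p s → n ≡ p + s → c + x ≡ Q * y + double p → Realization (x + c) (L x 0 c)
  yRealization-even c zero p s en eq = ⊥-elim (c+[1+a+b]≢a c (double p) (double s) (trans (cong (λ z → c + suc z) (sym hD)) eq))
    where hD = trans (cong double en) (double-+ p s)
  yRealization-even c (suc q) p s en eq with ySnakeBackward p s q eqx
    where hD = trans (cong double en) (double-+ p s)
          eqx : x ≡ double s + suc (double p)
          eqx = trans (cong suc (trans hD (+-comm (double p) (double s)))) (sym (+-suc (double s) (double p)))
  ... | rs , cv , pt = realize cv (↭-trans (columns-grid y q (suc (double p)) (suc (double s)) eqy) (↭-reflexive (cong (interval 0) eqg)))
                         (walk-↭ pt (L-cong ea refl ec))
    where
    hD = trans (cong double en) (double-+ p s)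
    eqy : y ≡ suc (double p) + suc (double s)
    eqy = cong suc (trans (cong suc hD) (sym (+-suc (double p) (double s))))
    eqg : gridSize y (suc (double p)) q ≡ suc (x + c)
    eqg = trans (gridSize≡ y (suc (double p)) q) (trans (+-suc (suc q * y) (double p)) (cong suc (trans (sym eq) (+-comm c x))))
    ea : suc (double s + double p) ≡ x
    ea = cong suc (trans (+-comm (double s) (double p)) (sym hD))
    ec : suc q + (q + (double s * q + double p * suc q)) ≡ c
    ec = sym (+-cancelʳ-≡ x c _ (trans eq (sym (trans (cong (λ z → (suc q + (q + (double s * q + double p * suc q))) + suc z) hD)
            (trans (size (double p) (double s) q) (cong (λ z → suc q * suc (suc z) + double p) (sym hD)))))))
      where
      size : ∀ Dp Ds q → (suc q + (q + (Ds * q + Dp * suc q))) + suc (Dp + Ds) ≡ suc q * suc (suc (Dp + Ds)) + Dp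
      size = solve-∀

  cancel-x : ∀ c cE R → c + x ≡ R → cE + x ≡ R → cE ≡ c
  cancel-x c cE R e1 e2 = sym (+-cancelʳ-≡ x c cE (trans e1 (sym e2)))

  gridSize-full : ∀ A → suc (A + x) ≡ suc x + A + 0
  gridSize-full A = size A x
    where
    size : ∀ A B → suc (A + B) ≡ suc B + A + 0
    size = solve-∀

  xySize : ∀ c → c + x ≡ double n + 1 + c
  xySize c = size c (double n)
    where
    size : ∀ c D → c + suc D ≡ D + 1 + c
    size = solve-∀

  yRealization-full : ∀ c G → c + x ≡ G * y + x → Realization (x + c) (L x 0 c)
  yRealization-full c G eq with ySnakeForward n 0 0 G
  ... | rs , cv , pt = realize cv (↭-trans (↭-reflexive (LP.++-identityʳ (columns y G 0 y)))
                                 (↭-trans (columns-grid y G 0 y refl) (↭-reflexive (cong (interval 0) eqg))))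
                         (walk-↭ pt (L-cong (+-comm (double n) 1) refl ec))
    where
    cG : c ≡ G * y
    cG = +-cancelʳ-≡ x c (G * y) eq
    eqg : gridSize y 0 G ≡ suc (x + c)
    eqg = trans (gridSize≡ y 0 G) (trans (sym (gridSize-full (G * y))) (cong suc (trans (+-comm (G * y) x) (cong (x +_) (sym cG)))))
    ec : G + (double n * G + (G + 0)) ≡ c
    ec = sym (trans cG (size (double n) G))
      where
      size : ∀ D G → G * suc (suc D) ≡ G + (D * G + (G + 0))
      size = solve-∀

  yRealization-odd : ∀ c Q p s → n ≡ p + s → c + x ≡ Q * y + suc (double p) → Realization (x + c) (L x 0 c)
  yRealization-odd c Q p zero en eq = yRealization-full c Q (trans eq (cong (λ z → Q * y + suc (double z)) (trans (sym (+-identityʳ p)) (sym en))))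
  yRealization-odd c zero p (suc s) en eq =
    ⊥-elim (c+[1+a+b]≢a c (suc (double p)) (suc (double s)) (trans (cong (λ z → c + suc z) (trans (sym (+-suc (double p) (suc (double s)))) (sym hD))) eq))
    where hD = trans (cong double en) (double-+ p (suc s))
  yRealization-odd c (suc q) p (suc s) en eq with ySnakeForward p (suc s) q (suc q)
  ... | rs , cv , pt = realize cv (↭-trans (columns-grid y q (double (suc p)) (double (suc s)) eqy) (↭-reflexive (cong (interval 0) eqg)))
                         (walk-↭ pt (L-cong ea refl ec))
    where
    S = double (suc s)
    hD : double n ≡ double p + S
    hD = trans (cong double en) (double-+ p (suc s))
    eqy : y ≡ double (suc p) + S
    eqy = cong (λ z → suc (suc z)) hD
    eqg : gridSize y (double (suc p)) q ≡ suc (x + c)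
    eqg = trans (gridSize≡ y (double (suc p)) q) (trans (+-suc (suc q * y) (suc (double p))) (cong suc (trans (sym eq) (+-comm c x))))
    ea : double p + suc S ≡ x
    ea = trans (+-suc (double p) S) (cong suc (sym hD))
    ec : suc q + (double p * suc q + (suc q + S * q)) ≡ c
    ec = cancel-x c _ _ eq (trans (cong (λ z → (suc q + (double p * suc q + (suc q + S * q))) + suc z) hD)
            (trans (size (double p) S q) (cong (λ z → suc q * suc (suc z) + suc (double p)) (sym hD))))
      where
      size : ∀ Dp Ds q → (suc q + (Dp * suc q + (suc q + Ds * q))) + suc (Dp + Ds) ≡ suc q * suc (suc (Dp + Ds)) + suc Dp
      size = solve-∀

  yRealization : ∀ c → Realization (x + c) (L x 0 c)
  yRealization c with divModY (c + x)
  ... | Q , ρ , le , eq with parity ρ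
  ...   | p , inj₁ refl with ≤⇒∃+ (double≤1+double⇒≤ p n le)
  ...     | s , en = yRealization-even c Q p s en eq
  yRealization c | Q , ρ , le , eq | p , inj₂ refl with ≤⇒∃+ (double-≤⇒≤ p n (≤-pred le))
  ...     | s , en = yRealization-odd c Q p s en eq

  xyRealization-full : ∀ c G → c + x ≡ G * y + x → Realization (double n + 1 + c) (L (double n) 1 c)
  xyRealization-full c G eq with xySnakeFull G
  ... | rs , cv , t , pt = realize cv (↭-trans (columns-grid y G 0 y refl) (↭-reflexive (cong (interval 0) eqg)))
                         (walk-↭ pt (L-cong {double n} {1} {y * G} {double n} {1} {c} refl refl (trans (*-comm y G) (sym cG))))
    where
    cG : c ≡ G * y
    cG = +-cancelʳ-≡ x c (G * y) eq
    eqg : gridSize y 0 G ≡ suc (double n + 1 + c)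
    eqg = trans (gridSize≡ y 0 G) (trans (sym (gridSize-full (G * y))) (cong suc (trans (cong (_+ x) (sym cG)) (xySize c))))

  xyRealization-even : ∀ c Q p s → n ≡ p + s → c + x ≡ Q * y + double p → Realization (double n + 1 + c) (L (double n) 1 c)
  xyRealization-even c zero p s en eq = ⊥-elim (c+[1+a+b]≢a c (double p) (double s) (trans (cong (λ z → c + suc z) (sym hD)) eq))
    where hD = trans (cong double en) (double-+ p s)
  xyRealization-even c (suc q) p s en eq with xySnakeForward p s q
  ... | rs , cv , t , pt = realize cv (↭-trans (columns-grid y q (suc (double p)) (suc (double s)) eqy) (↭-reflexive (cong (interval 0) eqg)))
                         (walk-↭ pt (L-cong (sym hD) refl ec))
    where
    hD = trans (cong double en) (double-+ p s)
    eqy : y ≡ suc (double p) + suc (double s)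
    eqy = cong suc (trans (cong suc hD) (sym (+-suc (double p) (double s))))
    eqg : gridSize y (suc (double p)) q ≡ suc (double n + 1 + c)
    eqg = trans (gridSize≡ y (suc (double p)) q) (trans (+-suc (suc q * y) (double p)) (cong suc (trans (sym eq) (xySize c))))
    ec : suc q + (double p * suc q + (q + double s * q)) ≡ c
    ec = cancel-x c _ _ eq (trans (cong (λ z → (suc q + (double p * suc q + (q + double s * q))) + suc z) hD)
            (trans (size (double p) (double s) q) (cong (λ z → suc q * suc (suc z) + double p) (sym hD))))
      where
      size : ∀ Dp Ds q → (suc q + (Dp * suc q + (q + Ds * q))) + suc (Dp + Ds) ≡ suc q * suc (suc (Dp + Ds)) + Dp
      size = solve-∀

  xyRealization-odd : ∀ c Q p s → n ≡ p + s → c + x ≡ Q * y + suc (double p) → Realization (double n + 1 + c) (L (double n) 1 c)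
  xyRealization-odd c Q p zero en eq = xyRealization-full c Q (trans eq (cong (λ z → Q * y + suc (double z)) (trans (sym (+-identityʳ p)) (sym en))))
  xyRealization-odd c zero p (suc s) en eq =
    ⊥-elim (c+[1+a+b]≢a c (suc (double p)) (suc (double s)) (trans (cong (λ z → c + suc z) (trans (sym (+-suc (double p) (suc (double s)))) (sym hD))) eq))
    where hD = trans (cong double en) (double-+ p (suc s))
  xyRealization-odd c (suc q) p (suc s) en eq with xySnakeBackward p s q eqx
    where
    hD = trans (cong double en) (double-+ p (suc s))
    eqx : x ≡ double s + suc (suc (suc (double p)))
    eqx = trans (cong suc hD) (rearrange (double p) (double s))
      where
      rearrange : ∀ a b → suc (a + suc (suc b)) ≡ b + suc (suc (suc a))
      rearrange = solve-∀
  ... | rs , cv , t , pt = realize cv (↭-trans (columns-grid y q (double (suc p)) (double (suc s)) eqy) (↭-reflexive (cong (interval 0) eqg)))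
                         (walk-↭ pt (L-cong ea refl ec))
    where
    hD : double n ≡ double p + suc (suc (double s))
    hD = trans (cong double en) (double-+ p (suc s))
    eqy : y ≡ double (suc p) + double (suc s)
    eqy = cong (λ z → suc (suc z)) hD
    eqg : gridSize y (double (suc p)) q ≡ suc (double n + 1 + c)
    eqg = trans (gridSize≡ y (double (suc p)) q) (trans (+-suc (suc q * y) (suc (double p))) (cong suc (trans (sym eq) (xySize c))))
    ea : 1 + (double s + (1 + double p)) ≡ double n
    ea = trans (ones (double p) (double s)) (sym hD)
      where
      ones : ∀ a b → suc (b + suc a) ≡ a + suc (suc b)
      ones = solve-∀
    ec : suc q + (q + (double s * q + (q + (suc q + double p * suc q)))) ≡ c
    ec = cancel-x c _ _ eq (trans (cong (λ z → (suc q + (q + (double s * q + (q + (suc q + double p * suc q))))) + suc z) hD)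
            (trans (size (double p) (double s) q) (cong (λ z → suc q * suc (suc z) + suc (double p)) (sym hD))))
      where
      size : ∀ Dp Ds q → (suc q + (q + (Ds * q + (q + (suc q + Dp * suc q))))) + suc (Dp + suc (suc Ds)) ≡ suc q * suc (suc (Dp + suc (suc Ds))) + suc Dp
      size = solve-∀

  xyRealization : ∀ c → Realization (double n + 1 + c) (L (double n) 1 c)
  xyRealization c with divModY (c + x)
  ... | Q , ρ , le , eq with parity ρ
  ...   | p , inj₁ refl with ≤⇒∃+ (double≤1+double⇒≤ p n le)
  ...     | s , en = xyRealization-even c Q p s en eq
  xyRealization c | Q , ρ , le , eq | p , inj₂ refl with ≤⇒∃+ (double-≤⇒≤ p n (≤-pred le))
  ...     | s , en = xyRealization-odd c Q p s en eq

  -- Zigzags: columns of height 1 (pairs j, j+w) traversed alternately, so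
  -- that each column costs one w-jump and each link between columns one
  -- jump of the other size (y-columns linked by x-jumps and vice versa).
  swapXY : suc x ∷ x ∷ [] ↭ x ∷ suc x ∷ []
  swapXY = swap (suc x) x ↭-refl

  zigzag-walk : ∀ j k → Walk (j + x) (columns y 1 j k) (k + j + x) (L 0 k k)
  zigzag-walk j zero = walk-[] (j + x)
  zigzag-walk j (suc k) =
    walk-end (walk-↭ (walk-++ (zigzag-walk j k) (walk-↭ (column-walk (k + j + x) (k + j) y 1) (∷⁺↭ (∣m+n-m∣≡n (k + j) x) ↭-refl)))
                (↭-trans (L-++ 0 k k 0 1 1) (L-cong′ 0 (k + 1) (k + 1) 0 (suc k) (suc k) refl (+-comm k 1) (+-comm k 1))))
         (+-suc (k + j) x)

  zigzagDown : ℕ → ℕ → List ℕ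
  zigzagDown j zero = []
  zigzagDown j (suc k) = columnDown (k + j) y 1 ++ zigzagDown j k

  zigzagDown-walk : ∀ j k → Walk (k + j) (zigzagDown j k) j (L 0 k k)
  zigzagDown-walk j zero = walk-[] j
  zigzagDown-walk j (suc k) =
    walk-↭ (walk-++ (walk-↭ (columnDown-walk (suc (k + j)) (k + j) y 1) (∷⁺↭ lk ↭-refl)) (zigzagDown-walk j k)) (L-++ 0 1 1 0 k k)
    where
    lk : ∣ suc (k + j) - (k + j + suc x) ∣ ≡ x
    lk = trans (cong (λ z → ∣ suc (k + j) - z ∣) (+-suc (k + j) x)) (∣m-m+n∣≡n (suc (k + j)) x)

  zigzagDown↭ : ∀ j k → zigzagDown j k ↭ columns y 1 j k
  zigzagDown↭ j zero = ↭-refl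
  zigzagDown↭ j (suc k) = ↭-trans (PP.++⁺ (columnDown↭column (k + j) y 1) (zigzagDown↭ j k)) (PP.++-comm (column (k + j) y 1) (columns y 1 j k))

  zigzagUp : ℕ → ℕ → List ℕ
  zigzagUp j zero = []
  zigzagUp j (suc k) = column (k + j) x 1 ++ zigzagUp j k

  zigzagUp-walk : ∀ j k → Walk (k + j + x) (zigzagUp j k) (j + x) (L 0 k k)
  zigzagUp-walk j zero = walk-[] (j + x)
  zigzagUp-walk j (suc k) =
    walk-↭ (walk-++ (walk-↭ (column-walk (suc (k + j + x)) (k + j) x 1) (∷⁺↭ lk ↭-refl)) (zigzagUp-walk j k))
          (↭-trans (PP.++⁺ʳ (L 0 k k) swapXY) (L-++ 0 1 1 0 k k))
    where
    lk : ∣ suc (k + j + x) - (k + j) ∣ ≡ suc x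
    lk = trans (cong (λ z → ∣ z - (k + j) ∣) (sym (+-suc (k + j) x))) (∣m+n-m∣≡n (k + j) (suc x))

  zigzagUp↭ : ∀ j k → zigzagUp j k ↭ columns x 1 j k
  zigzagUp↭ j zero = ↭-refl
  zigzagUp↭ j (suc k) = ↭-trans (PP.++⁺ˡ (column (k + j) x 1) (zigzagUp↭ j k)) (PP.++-comm (column (k + j) x 1) (columns x 1 j k))

  ones≡L : ∀ s → replicate s 1 ↭ L s 0 0
  ones≡L s = ↭-reflexive (sym (LP.++-identityʳ (replicate s 1)))

  firstJumpY : Walk 0 (y ∷ []) y (L 0 0 1)
  firstJumpY = single-walk 0 y y (∣m-m+n∣≡n 0 y)

  firstJumpX : Walk 0 (x ∷ []) x (L 0 1 0)
  firstJumpX = single-walk 0 x x (∣m-m+n∣≡n 0 x)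

  -- After the jump 0 → y it zigzags over the first
  -- 2k+1 columns of height 1 and finishes them with a snake.  Blocks with
  -- k = n contain no 1's; m of them realize {x^(m x), y^(m y)}.
  mixedBlock : ∀ k t → n ≡ k + t → Perfect (x + y) (L (double t) (suc (double k)) y)
  mixedBlock k t en = perfect (y ∷ (columns y 1 1 r ++ riseDU y 1 r t))
    (↭-trans (PP.++⁺ˡ (column 0 y 1) (PP.++⁺ˡ (columns y 1 1 r) (riseDU↭ y 1 r t)))
      (↭-trans (↭-reflexive (trans (sym (LP.++-assoc (column 0 y 1) (columns y 1 1 r) (columns y 1 (suc r) (double t))))
                 (trans (cong (_++ columns y 1 (suc r) (double t)) (sym (columns-cons y 1 0 r)))
                 (trans (cong (λ z → columns y 1 0 (suc r) ++ columns y 1 z (double t)) (sym (+-identityʳ (suc r))))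
                 (trans (columns-++ y 1 0 (suc r) (double t)) (cong (columns y 1 0) eqy))))))
      (↭-trans (columns-grid y 1 0 y refl) (↭-reflexive (cong (interval 0) (size x))))))
    (walk-end (walk-↭ (walk-++ firstJumpY
                   (walk-++ (zigzag-walk 1 r) (walk-start (riseDU-walk y 1 r t) (sym (+-assoc r 1 x)))))
             (↭-trans (PP.++⁺ˡ (L 0 0 1) (L-++ 0 r r (double t) 0 (double t * 1)))
               (↭-trans (L-++ 0 0 1 (double t) (r + 0) (r + double t * 1))
                 (L-cong refl (+-identityʳ r) (cong suc eqc)))))
         (cong (_+ y) (trans (snakeEnd≡ r t) eqx)))
    where
    r = suc (double k)
    size : ∀ x → suc x + (suc x + 0) ≡ suc (x + suc x)
    size = solve-∀
    hD : double n ≡ double k + double t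
    hD = trans (cong double en) (double-+ k t)
    eqx : double t + r ≡ x
    eqx = trans (+-comm (double t) r) (cong suc (sym hD))
    eqc : r + double t * 1 ≡ x
    eqc = trans (cong (r +_) (*-identityʳ (double t))) (cong suc (sym hD))
    eqy : double t + suc r ≡ y
    eqy = trans (+-suc (double t) r) (cong suc eqx)

  -- r = c = c'+1: jump 0 → y, zigzag over the first c' columns, an
  -- x-jump down to column c'+1, then count up through the single vertices.
  tailZigzag : ∀ c' s → x ≡ suc c' + s → Realization (s + suc c' + suc c') (L s (suc c') (suc c'))
  tailZigzag c' s hx = realize {K = columns y 1 0 (suc c') ++ columns y 0 (suc c') (suc s)}
      (↭-reflexive (trans (sym (LP.++-assoc (column 0 y 1) (columns y 1 1 c') (interval (suc c') (suc s))))
                    (cong₂ _++_ (sym (columns-cons y 1 0 c')) (sym (columns-flat y (suc c') (suc s))))))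
      (↭-trans (columns-grid y 0 (suc c') (suc s) eqy) (↭-reflexive (cong (interval 0) (trans (cong (_+ suc c') (cong suc hx)) (size c' s)))))
      (walk-↭ (walk-++ firstJumpY (walk-++ (zigzag-walk 1 c') (walk-++ (single-walk (c' + 1 + x) (suc c') x lk) (walk-↭ (interval-walk (suc c') s) (ones≡L s)))))
        (↭-trans (PP.++⁺ˡ (L 0 0 1) (PP.++⁺ˡ (L 0 c' c') (L-++ 0 1 0 s 0 0)))
        (↭-trans (PP.++⁺ˡ (L 0 0 1) (L-++ 0 c' c' s 1 0))
        (↭-trans (L-++ 0 0 1 s (c' + 1) (c' + 0))
          (L-cong′ s (c' + 1) (suc (c' + 0)) s (suc c') (suc c') refl (+-comm c' 1) (cong suc (+-identityʳ c')))))))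
    where
    size : ∀ c s → suc (suc c + s) + suc c ≡ suc (s + suc c + suc c)
    size = solve-∀
    eqy : y ≡ suc c' + suc s
    eqy = trans (cong suc hx) (sym (+-suc (suc c') s))
    lk : ∣ c' + 1 + x - suc c' ∣ ≡ x
    lk = trans (cong (λ z → ∣ z + x - suc c' ∣) (+-comm c' 1)) (∣m+n-m∣≡n (suc c') x)

  -- The perfect block 0, x, x-1, …, 1, x+1 realizing {1^(x-1), x^2}.
  countdownBlock : Perfect (double n + 2 + 0) (L (double n) 2 0)
  countdownBlock = perfect (x ∷ (countdown 1 (double n) ++ (suc x ∷ [])))
    (↭-trans (prep 0 (PP.++⁺ (↭-trans (↭-reflexive (cong (_∷ countdown 1 (double n)) (+-comm 1 (double n)))) (countdown↭ 1 x))
                               (↭-reflexive (cong (_∷ []) (+-comm 1 x)))))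
             (↭-reflexive (cong (λ z → 0 ∷ z) (trans (sym (interval-snoc 1 x)) (cong (interval 1) eN)))))
    (walk-end (walk-↭ (walk-++ firstJumpX (walk-++ (walk-↭ (walk-start (countdown-walk 1 (double n)) (+-comm (double n) 1)) (ones≡L (double n))) (single-walk 1 (suc x) x (∣m-m+n∣≡n 1 x))))
            (↭-trans (PP.++⁺ˡ (L 0 1 0) (L-++ (double n) 0 0 0 1 0))
            (↭-trans (L-++ 0 1 0 (double n + 0) (0 + 1) 0) (L-cong′ (double n + 0) (1 + (0 + 1)) 0 (double n) 2 0 (+-identityʳ (double n)) refl refl))))
          eN)
    where
    eN : suc x ≡ double n + 2 + 0
    eN = size (double n)
      where
      size : ∀ D → suc (suc D) ≡ D + 2 + 0
      size = solve-∀

  -- c = 2u + r + 1 (and c = 2u + r + 2 in the primed variant): jump 0 → y,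
  -- count down the single vertices, then move left by a snake over 2u
  -- columns of height 1 and a zigzag over the remaining r.
  tailYGrid : ∀ Lu k s → x ≡ double Lu + k + s →
        Realization ((s + double Lu) + k + suc (double Lu + k)) (L (s + double Lu) k (suc (double Lu + k)))
  tailYGrid Lu k s hx = realize {K = columns y 1 0 K1 ++ columns y 0 K1 s}
      (↭-trans (PP.++⁺ˡ (column 0 y 1) (PP.++⁺ (↭-trans (countdown↭ K1 s) (↭-reflexive (sym (columns-flat y K1 s))))
                                     (PP.++⁺ (fallUD↭ y 1 (suc k) Lu) (zigzagDown↭ 1 k))))
      (↭-trans (solve 4 (λ X S D Z → X ⊕ (S ⊕ (D ⊕ Z)) ⊜ ((X ⊕ Z) ⊕ D) ⊕ S) ↭-refl
                  (column 0 y 1) (columns y 0 K1 s) (columns y 1 (suc k) (double Lu)) (columns y 1 1 k))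
        (↭-reflexive (cong (_++ columns y 0 K1 s)
          (trans (cong₂ _++_ (sym (columns-cons y 1 0 k)) (cong (λ z → columns y 1 z (double Lu)) (sym (+-identityʳ (suc k)))))
                 (columns-++ y 1 0 (suc k) (double Lu)))))))
      (↭-trans (columns-grid y 0 K1 s eqy) (↭-reflexive (cong (interval 0) eqN)))
      (walk-↭ (walk-++ firstJumpY (walk-++ (walk-↭ (walk-start (countdown-walk K1 s) e1) (ones≡L s))
                (walk-++ (fallUD-walk y 1 (suc k) Lu) (walk-start (zigzagDown-walk 1 k) (+-comm k 1)))))
        (↭-trans (PP.++⁺ˡ (L 0 0 1) (PP.++⁺ˡ (L s 0 0) (L-++ (double Lu) 0 (double Lu * 1) 0 k k)))
        (↭-trans (PP.++⁺ˡ (L 0 0 1) (L-++ s 0 0 (double Lu + 0) k (double Lu * 1 + k)))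
        (↭-trans (L-++ 0 0 1 (s + (double Lu + 0)) k (double Lu * 1 + k))
          (L-cong′ (s + (double Lu + 0)) k (suc (double Lu * 1 + k)) (s + double Lu) k (suc (double Lu + k))
               (cong (s +_) (+-identityʳ (double Lu))) refl (cong (λ z → suc (z + k)) (*-identityʳ (double Lu))))))))
    where
    K1 = double Lu + suc k
    base : ∀ D k s → s + (D + suc k) ≡ suc (D + k + s)
    base = solve-∀
    size : ∀ D k s → s + (D + suc k) + (D + suc k) ≡ suc ((s + D) + k + suc (D + k))
    size = solve-∀
    e1 : s + K1 ≡ y
    e1 = trans (base (double Lu) k s) (cong suc (sym hx))
    eqy : y ≡ K1 + s
    eqy = trans (sym e1) (+-comm s K1)
    eqN : gridSize y K1 0 ≡ suc ((s + double Lu) + k + suc (double Lu + k))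
    eqN = trans (cong (_+ K1) (sym e1)) (size (double Lu) k s)

  tailYGrid′ : ∀ Lu k s → x ≡ double Lu + suc k + s →
        Realization (suc (s + double Lu) + k + suc (suc (double Lu + k))) (L (suc (s + double Lu)) k (suc (suc (double Lu + k))))
  tailYGrid′ Lu k s hx = realize {K = columns y 1 0 K1 ++ columns y 0 K1 s}
      (↭-trans (PP.++⁺ˡ (column 0 y 1) (PP.++⁺ (↭-trans (countdown↭ K1 s) (↭-reflexive (sym (columns-flat y K1 s))))
                                     (PP.++⁺ (fallUD↭ y 1 (suc (suc k)) Lu) (PP.++⁺ (zigzagDown↭ 2 k) (↭-refl {x = column 1 y 1})))))
      (↭-trans (solve 5 (λ X S D Z C → X ⊕ (S ⊕ (D ⊕ (Z ⊕ C))) ⊜ ((X ⊕ (C ⊕ Z)) ⊕ D) ⊕ S) ↭-refl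
                  (column 0 y 1) (columns y 0 K1 s) (columns y 1 (suc (suc k)) (double Lu)) (columns y 1 2 k) (column 1 y 1))
        (↭-reflexive (cong (_++ columns y 0 K1 s)
          (trans (cong₂ _++_ (trans (cong (column 0 y 1 ++_) (sym (columns-cons y 1 1 k))) (sym (columns-cons y 1 0 (suc k))))
                              (cong (λ z → columns y 1 z (double Lu)) (sym (+-identityʳ (suc (suc k))))))
                 (columns-++ y 1 0 (suc (suc k)) (double Lu)))))))
      (↭-trans (columns-grid y 0 K1 s eqy) (↭-reflexive (cong (interval 0) eqN)))
      (walk-↭ (walk-++ firstJumpY (walk-++ (walk-↭ (walk-start (countdown-walk K1 s) e1) (ones≡L s))
                (walk-++ (fallUD-walk y 1 (suc (suc k)) Lu) (walk-++ (walk-start (zigzagDown-walk 2 k) (+-comm k 2)) (column-walk₁ 2 1 y 1 (∣1+n-n∣≡1 1))))))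
        (↭-trans (PP.++⁺ˡ (L 0 0 1) (PP.++⁺ˡ (L s 0 0) (PP.++⁺ˡ (L (double Lu) 0 (double Lu * 1)) (L-++ 0 k k 1 0 1))))
        (↭-trans (PP.++⁺ˡ (L 0 0 1) (PP.++⁺ˡ (L s 0 0) (L-++ (double Lu) 0 (double Lu * 1) 1 (k + 0) (k + 1))))
        (↭-trans (PP.++⁺ˡ (L 0 0 1) (L-++ s 0 0 (double Lu + 1) (k + 0) (double Lu * 1 + (k + 1))))
        (↭-trans (L-++ 0 0 1 (s + (double Lu + 1)) (k + 0) (double Lu * 1 + (k + 1)))
          (L-cong′ (s + (double Lu + 1)) (k + 0) (suc (double Lu * 1 + (k + 1))) (suc (s + double Lu)) k (suc (suc (double Lu + k)))
               (+1-comm s (double Lu)) (+-identityʳ k)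
               (cong suc (trans (cong (λ z → z + (k + 1)) (*-identityʳ (double Lu))) (+1-comm (double Lu) k)))))))))
    where
    K1 = double Lu + suc (suc k)
    +1-comm : ∀ a b → a + (b + 1) ≡ suc (a + b)
    +1-comm = solve-∀
    base : ∀ D k s → s + (D + suc (suc k)) ≡ suc (D + suc k + s)
    base = solve-∀
    size : ∀ D k s → s + (D + suc (suc k)) + (D + suc (suc k)) ≡ suc (suc (s + D) + k + suc (suc (D + k)))
    size = solve-∀
    e1 : s + K1 ≡ y
    e1 = trans (base (double Lu) k s) (cong suc (sym hx))
    eqy : y ≡ K1 + s
    eqy = trans (sym e1) (+-comm s K1)
    eqN : gridSize y K1 0 ≡ suc (suc (s + double Lu) + k + suc (suc (double Lu + k)))
    eqN = trans (cong (_+ K1) (sym e1)) (size (double Lu) k s)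

  -- r = c + 2u + 2 (and r = c + 2u + 3 in the primed variant): the mirror
  -- image on a grid of x-columns: jump 0 → x, count down the single
  -- vertices, climb column ρ, then a zigzag (linked by y-jumps) and a snake
  -- moving left.
  tailXGrid : ∀ Lu k s → x ≡ suc (k + (double Lu + 1)) + s →
        Realization (suc (s + double Lu) + suc (suc (k + double Lu)) + k) (L (suc (s + double Lu)) (suc (suc (k + double Lu))) k)
  tailXGrid Lu k s hx = realize {K = columns x 1 0 (suc ρ) ++ columns x 0 (suc ρ) s}
      (↭-trans (PP.++⁺ˡ (column 0 x 1) (PP.++⁺ (↭-trans (countdown↭ (suc ρ) s) (↭-reflexive (sym (columns-flat x (suc ρ) s))))
                                     (PP.++⁺ˡ (column ρ x 1) (PP.++⁺ (zigzagUp↭ J k) (fallDU↭ x 1 1 Lu)))))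
      (↭-trans (solve 5 (λ X S C Z D → X ⊕ (S ⊕ (C ⊕ (Z ⊕ D))) ⊜ (((X ⊕ D) ⊕ Z) ⊕ C) ⊕ S) ↭-refl
                  (column 0 x 1) (columns x 0 (suc ρ) s) (column ρ x 1) (columns x 1 J k) (columns x 1 1 (double Lu)))
        (↭-reflexive (cong (_++ columns x 0 (suc ρ) s)
          (cong₂ _++_ (trans (cong₂ _++_ (columns-++ x 1 0 1 (double Lu)) (cong (λ z → columns x 1 z k) (sym (+-identityʳ J))))
                             (columns-++ x 1 0 J k))
                      (cong (λ z → column z x 1) (sym (+-identityʳ ρ))))))))
      (↭-trans (columns-grid x 0 (suc ρ) s eqx) (↭-reflexive (cong (interval 0) eqN)))
      (walk-↭ (walk-++ firstJumpX (walk-++ (walk-↭ (walk-start (countdown-walk (suc ρ) s) e1) (ones≡L s))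
                (walk-++ (walk-↭ (column-walk₁ (suc ρ) ρ x 1 (∣1+n-n∣≡1 ρ)) (↭-reflexive (OnesAnd≡L 1 1)))
                (walk-++ (zigzagUp-walk J k) (walk-↭ (fallDU-walk x 1 1 Lu) (↭-reflexive (OnesAnd≡L (double Lu) (double Lu * 1))))))))
        (↭-trans (PP.++⁺ˡ (L 0 1 0) (PP.++⁺ˡ (L s 0 0) (PP.++⁺ˡ (L 1 1 0) (L-++ 0 k k (double Lu) (double Lu * 1) 0))))
        (↭-trans (PP.++⁺ˡ (L 0 1 0) (PP.++⁺ˡ (L s 0 0) (L-++ 1 1 0 (double Lu) (k + double Lu * 1) (k + 0))))
        (↭-trans (PP.++⁺ˡ (L 0 1 0) (L-++ s 0 0 (1 + double Lu) (1 + (k + double Lu * 1)) (k + 0)))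
        (↭-trans (L-++ 0 1 0 (s + suc (double Lu)) (1 + (k + double Lu * 1)) (k + 0))
          (L-cong′ (s + suc (double Lu)) (suc (suc (k + double Lu * 1))) (k + 0) (suc (s + double Lu)) (suc (suc (k + double Lu))) k
               (+-suc s (double Lu)) (cong (λ z → suc (suc (k + z))) (*-identityʳ (double Lu))) (+-identityʳ k)))))))
    where
    J = double Lu + 1
    ρ = k + J
    e1 : s + suc ρ ≡ x
    e1 = trans (+-comm s (suc ρ)) (sym hx)
    eqx : x ≡ suc ρ + s
    eqx = hx
    eqN : gridSize x (suc ρ) 0 ≡ suc (suc (s + double Lu) + suc (suc (k + double Lu)) + k)
    eqN = trans (cong (_+ suc ρ) hx) (size (double Lu) k s)
      where
      size : ∀ D k s → suc (k + (D + 1)) + s + suc (k + (D + 1)) ≡ suc (suc (s + D) + suc (suc (k + D)) + k)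
      size = solve-∀

  tailXGrid′ : ∀ Lu k s → x ≡ suc (k + (double Lu + 2)) + s →
        Realization (suc (suc (s + double Lu)) + suc (suc (suc (k + double Lu))) + k) (L (suc (suc (s + double Lu))) (suc (suc (suc (k + double Lu)))) k)
  tailXGrid′ Lu k s hx = realize {K = columns x 1 0 (suc ρ) ++ columns x 0 (suc ρ) s}
      (↭-trans (PP.++⁺ˡ (column 0 x 1) (PP.++⁺ (↭-trans (countdown↭ (suc ρ) s) (↭-reflexive (sym (columns-flat x (suc ρ) s))))
                                     (PP.++⁺ˡ (column ρ x 1) (PP.++⁺ (zigzagUp↭ J k) (PP.++⁺ (fallDU↭ x 1 2 Lu) (columnDown↭column 1 x 1))))))
      (↭-trans (solve 6 (λ X S C Z D C1 → X ⊕ (S ⊕ (C ⊕ (Z ⊕ (D ⊕ C1)))) ⊜ ((((X ⊕ C1) ⊕ D) ⊕ Z) ⊕ C) ⊕ S) ↭-refl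
                  (column 0 x 1) (columns x 0 (suc ρ) s) (column ρ x 1) (columns x 1 J k) (columns x 1 2 (double Lu)) (column 1 x 1))
        (↭-reflexive (cong (_++ columns x 0 (suc ρ) s)
          (cong₂ _++_ (trans (cong₂ _++_ (columns-++ x 1 0 2 (double Lu)) (cong (λ z → columns x 1 z k) (sym (+-identityʳ J))))
                             (columns-++ x 1 0 J k))
                      (cong (λ z → column z x 1) (sym (+-identityʳ ρ))))))))
      (↭-trans (columns-grid x 0 (suc ρ) s eqx) (↭-reflexive (cong (interval 0) eqN)))
      (walk-↭ (walk-++ firstJumpX (walk-++ (walk-↭ (walk-start (countdown-walk (suc ρ) s) e1) (ones≡L s))
                (walk-++ (walk-↭ (column-walk₁ (suc ρ) ρ x 1 (∣1+n-n∣≡1 ρ)) (↭-reflexive (OnesAnd≡L 1 1)))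
                (walk-++ (zigzagUp-walk J k) (walk-++ (walk-↭ (fallDU-walk x 1 2 Lu) (↭-reflexive (OnesAnd≡L (double Lu) (double Lu * 1))))
                   (walk-↭ (columnDown-walk₁ (peak 2 x 1) 1 x 1 (∣1+n-n∣≡1 (1 + x))) (↭-reflexive (OnesAnd≡L 1 1))))))))
        (↭-trans (PP.++⁺ˡ (L 0 1 0) (PP.++⁺ˡ (L s 0 0) (PP.++⁺ˡ (L 1 1 0) (PP.++⁺ˡ (L 0 k k) (L-++ (double Lu) (double Lu * 1) 0 1 1 0)))))
        (↭-trans (PP.++⁺ˡ (L 0 1 0) (PP.++⁺ˡ (L s 0 0) (PP.++⁺ˡ (L 1 1 0) (L-++ 0 k k (double Lu + 1) (double Lu * 1 + 1) 0))))
        (↭-trans (PP.++⁺ˡ (L 0 1 0) (PP.++⁺ˡ (L s 0 0) (L-++ 1 1 0 (double Lu + 1) (k + (double Lu * 1 + 1)) (k + 0))))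
        (↭-trans (PP.++⁺ˡ (L 0 1 0) (L-++ s 0 0 (1 + (double Lu + 1)) (1 + (k + (double Lu * 1 + 1))) (k + 0)))
        (↭-trans (L-++ 0 1 0 (s + (1 + (double Lu + 1))) (1 + (k + (double Lu * 1 + 1))) (k + 0))
          (L-cong′ (s + (1 + (double Lu + 1))) (suc (suc (k + (double Lu * 1 + 1)))) (k + 0)
               (suc (suc (s + double Lu))) (suc (suc (suc (k + double Lu)))) k
               (ones s (double Lu)) (cong (λ z → suc (suc z)) (trans (cong (λ z → k + (z + 1)) (*-identityʳ (double Lu))) (+1-comm k (double Lu))))
               (+-identityʳ k))))))))
    where
    ones : ∀ s D → s + (1 + (D + 1)) ≡ suc (suc (s + D))
    ones = solve-∀
    +1-comm : ∀ a b → a + (b + 1) ≡ suc (a + b)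
    +1-comm = solve-∀
    J = double Lu + 2
    ρ = k + J
    e1 : s + suc ρ ≡ x
    e1 = trans (+-comm s (suc ρ)) (sym hx)
    eqx : x ≡ suc ρ + s
    eqx = hx
    eqN : gridSize x (suc ρ) 0 ≡ suc (suc (suc (s + double Lu)) + suc (suc (suc (k + double Lu))) + k)
    eqN = trans (cong (_+ suc ρ) hx) (size (double Lu) k s)
      where
      size : ∀ D k s → suc (k + (D + 2)) + s + suc (k + (D + 2)) ≡ suc (suc (suc (s + D)) + suc (suc (suc (k + D))) + k)
      size = solve-∀

  -- r = 2, c = 1 (needs x ≥ 5): 0, x, x-1, …, 2, y+2, y+1, y, 1.
  tailSpecial : ∀ n' → n ≡ suc n' → Realization (x + 2 + 1) (L x 2 1)
  tailSpecial n' en = realize {K = 0 ∷ 1 ∷ (interval 2 (suc (suc D')) ++ (y ∷ suc y ∷ suc (suc y) ∷ []))}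
      (prep 0 (↭-trans (PP.++⁺ʳ (suc (suc y) ∷ suc y ∷ y ∷ 1 ∷ [])
                  (↭-trans (↭-reflexive (cong (_∷ countdown 2 (suc D')) (sym e2))) (countdown↭ 2 (suc (suc D')))))
               (solve 5 (λ A P Q R O → A ⊕ (P ⊕ (Q ⊕ (R ⊕ O))) ⊜ O ⊕ (A ⊕ (R ⊕ (Q ⊕ P)))) ↭-refl
                  (interval 2 (suc (suc D'))) (suc (suc y) ∷ []) (suc y ∷ []) (y ∷ []) (1 ∷ []))))
      (↭-reflexive (cong (λ z → 0 ∷ 1 ∷ z)
         (trans (cong (interval 2 (suc (suc D')) ++_) (cong (λ z → interval z 3) ey))
         (trans (sym (interval-++ 2 (suc (suc D')) 3)) (cong (interval 2) size)))))
      (walk-↭ (walk-++ firstJumpX (walk-++ (walk-↭ (walk-start (countdown-walk 2 (suc D')) e2) (ones≡L (suc D')))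
               (walk-++ (single-walk 2 (suc (suc y)) y (∣m-m+n∣≡n 2 y)) (walk-++ (single-walk (suc (suc y)) (suc y) 1 (∣1+n-n∣≡1 (suc y)))
                 (walk-++ (single-walk (suc y) y 1 (∣1+n-n∣≡1 y)) (single-walk y 1 x (∣m+n-m∣≡n 1 x)))))))
        (↭-trans (PP.++⁺ˡ (L 0 1 0) (PP.++⁺ˡ (L (suc D') 0 0)
            (solve 4 (λ A B C D → A ⊕ (B ⊕ (C ⊕ D)) ⊜ B ⊕ (C ⊕ (D ⊕ A))) ↭-refl (y ∷ []) (1 ∷ []) (1 ∷ []) (x ∷ []))))
        (↭-trans (PP.++⁺ˡ (L 0 1 0) (L-++ (suc D') 0 0 2 1 1))
        (↭-trans (L-++ 0 1 0 (suc D' + 2) 1 1) (L-cong′ (suc D' + 2) 2 1 x 2 1 e2 refl refl)))))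
    where
    D' = double n'
    hx : x ≡ suc (suc (suc D'))
    hx = cong (λ z → suc (double z)) en
    e2 : suc D' + 2 ≡ x
    e2 = trans (+-comm (suc D') 2) (sym hx)
    size : suc (suc D') + 3 ≡ double n + 2 + 1
    size = trans (sym (+-assoc (suc (suc D')) 2 1)) (cong (λ z → z + 2 + 1) (sym (cong pred hx)))
    ey : y ≡ 2 + suc (suc D')
    ey = cong suc hx

  realization-cong : ∀ a b c {a' b' c'} → a ≡ a' → b ≡ b' → c ≡ c' → Realization (a + b + c) (L a b c) → Realization (a' + b' + c') (L a' b' c')
  realization-cong a b c refl refl refl r = r

  perfect⊕realizationᴸ : ∀ {N1 N2} a1 b1 c1 a2 b2 c2 → Perfect N1 (L a1 b1 c1) → N1 ≡ a1 + b1 + c1 → Realization N2 (L a2 b2 c2) → N2 ≡ a2 + b2 + c2 →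
           Realization ((a1 + a2) + (b1 + b2) + (c1 + c2)) (L (a1 + a2) (b1 + b2) (c1 + c2))
  perfect⊕realizationᴸ a1 b1 c1 a2 b2 c2 P e1 R e2 =
    realization-size (realization-↭ (perfect⊕realization P R) (L-++ a1 b1 c1 a2 b2 c2)) (trans (cong₂ _+_ e1 e2) (size a1 b1 c1 a2 b2 c2))
    where
    size : ∀ a1 b1 c1 a2 b2 c2 → (a1 + b1 + c1) + (a2 + b2 + c2) ≡ (a1 + a2) + (b1 + b2) + (c1 + c2)
    size = solve-∀

  -- Tail r c: a realization of {1^a', x^r, y^c} with a' ≤ 4n (a' ≤ x if
  -- r = 0).  These bounds are what make the hypotheses of the theorem
  -- sufficient.
  onesBound : ℕ → ℕ
  onesBound zero = x
  onesBound (suc _) = double (double n)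

  Tail : ℕ → ℕ → Set
  Tail r c = Σ ℕ λ a2 → (a2 ≤ onesBound r) × Realization (a2 + r + c) (L a2 r c)

  Tail-cong : ∀ {r r' c c'} → r ≡ r' → c ≡ c' → Tail r c → Tail r' c'
  Tail-cong refl refl t = t

  module Tails (n' : ℕ) (en : n ≡ suc n') where
    x≤4n : x ≤ double (double n)
    x≤4n = subst (λ m → suc (double m) ≤ double (double m)) (sym en) (≤-by (suc (double n')) (size n'))
      where
      open ≡-Reasoning
      size : ∀ n' → double (double (suc n')) ≡ suc (double (suc n')) + suc (double n')
      size n' = begin
        double (double (suc n'))                 ≡⟨ double≡ (double (suc n')) ⟩
        double (suc n') + double (suc n')        ≡⟨ cong (λ z → suc (suc z) + suc (suc z)) (double≡ n') ⟩
        suc (suc (n' + n')) + suc (suc (n' + n')) ≡⟨ rearrange n' ⟩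
        suc (suc (suc (n' + n'))) + suc (n' + n') ≡⟨ cong (λ z → suc (suc (suc z)) + suc z) (sym (double≡ n')) ⟩
        suc (double (suc n')) + suc (double n')  ∎
        where
        rearrange : ∀ n' → suc (suc (n' + n')) + suc (suc (n' + n')) ≡ suc (suc (suc (n' + n'))) + suc (n' + n')
        rearrange = solve-∀

    bounded : ∀ {a2} r → a2 ≤ x → a2 ≤ onesBound r
    bounded zero h = h
    bounded (suc r) h = ≤-trans h x≤4n

    -- Large c, r odd or even: a mixed block with r x-jumps followed by a
    -- y-realization, or by an xy-realization which supplies the last x-jump.
    tail-odd : ∀ k0 t c' → n ≡ suc k0 + t → Tail (suc (double (suc k0))) (y + c')
    tail-odd k0 t c' en2 = (double t + x) ,
      ≤-by (suc (double k0)) (trans (cong (λ z → double (double z)) en2) (trans (size k0 t) (cong (λ z → (double t + suc (double z)) + suc (double k0)) (sym en2)))) ,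
      realization-cong (double t + x) (r + 0) (y + c') refl (+-identityʳ r) refl (perfect⊕realizationᴸ (double t) r y x 0 c' (mixedBlock (suc k0) t en2) (cong (_+ y) hx) (yRealization c') (cong (_+ c') (sym (+-identityʳ x))))
      where
      r = suc (double (suc k0))
      size : ∀ k0 t → double (double (suc k0 + t)) ≡ (double t + suc (double (suc k0 + t))) + suc (double k0)
      size k0 t = trans (double≡ (double (suc k0 + t))) (trans (cong (λ z → z + z) (double-+ (suc k0) t))
                    (trans (rearrange (double k0) (double t)) (cong (λ z → (double t + suc z) + suc (double k0)) (sym (double-+ (suc k0) t)))))
        where
        rearrange : ∀ Dk Dt → (suc (suc Dk) + Dt) + (suc (suc Dk) + Dt) ≡ (Dt + suc (suc (suc Dk) + Dt)) + suc Dk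
        rearrange = solve-∀
      hx : x ≡ double t + r
      hx = trans (cong suc (trans (cong double en2) (trans (double-+ (suc k0) t) (+-comm (double (suc k0)) (double t)))))
                 (sym (+-suc (double t) (double (suc k0))))

    tail-even : ∀ k t c' → n ≡ k + t → Tail (suc (suc (double k))) (y + c')
    tail-even k t c' en2 = (double t + double n) ,
      ≤-trans (+-monoˡ-≤ (double n) dt) (≤-reflexive (sym (double≡ (double n)))) ,
      realization-cong (double t + double n) (suc (double k) + 1) (y + c') refl (cong suc (+-comm (double k) 1)) refl (perfect⊕realizationᴸ (double t) (suc (double k)) y (double n) 1 c' (mixedBlock k t en2) (cong (_+ y) hx) (xyRealization c') refl)
      where
      hD : double n ≡ double k + double t
      hD = trans (cong double en2) (double-+ k t)
      dt : double t ≤ double n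
      dt = subst (double t ≤_) (sym hD) (m≤n+m (double t) (double k))
      hx : x ≡ double t + suc (double k)
      hx = trans (cong suc (trans hD (+-comm (double k) (double t)))) (sym (+-suc (double t) (double k)))

    tail-yGrid : ∀ Lu r s → x ≡ double Lu + r + s → Tail r (suc (double Lu + r))
    tail-yGrid Lu r s hx = (s + double Lu) , bounded r (≤-by r (trans hx (size (double Lu) r s))) , tailYGrid Lu r s hx
      where
      size : ∀ D r s → D + r + s ≡ (s + D) + r
      size = solve-∀

    tail-yGrid′ : ∀ Lu r s → x ≡ double Lu + suc r + s → Tail r (suc (suc (double Lu + r)))
    tail-yGrid′ Lu r s hx = suc (s + double Lu) , bounded r (≤-by r (trans hx (size (double Lu) r s))) , tailYGrid′ Lu r s hx
      where
      size : ∀ D r s → D + suc r + s ≡ suc (s + D) + r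
      size = solve-∀

    tail-zigzag : ∀ c' s → x ≡ suc c' + s → Tail (suc c') (suc c')
    tail-zigzag c' s hx = s , bounded (suc c') (≤-by (suc c') (trans hx (+-comm (suc c') s))) , tailZigzag c' s hx

    tail-xGrid : ∀ Lu k s → x ≡ suc (k + (double Lu + 1)) + s → Tail (suc (suc (k + double Lu))) k
    tail-xGrid Lu k s hx = suc (s + double Lu) , bounded (suc (suc (k + double Lu))) (≤-by (suc k) (trans hx (size (double Lu) k s))) , tailXGrid Lu k s hx
      where
      size : ∀ D k s → suc (k + (D + 1)) + s ≡ suc (s + D) + suc k
      size = solve-∀

    tail-xGrid′ : ∀ Lu k s → x ≡ suc (k + (double Lu + 2)) + s → Tail (suc (suc (suc (k + double Lu)))) k
    tail-xGrid′ Lu k s hx = suc (suc (s + double Lu)) , bounded (suc (suc (suc (k + double Lu)))) (≤-by (suc k) (trans hx (size (double Lu) k s))) , tailXGrid′ Lu k s hx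
      where
      size : ∀ D k s → suc (k + (D + 2)) + s ≡ suc (suc (s + D)) + suc k
      size = solve-∀

    -- r = c + 1 ≥ 3: the countdown block followed by a y-grid tail.
    tail-countdown : ∀ c2 s' → x ≡ suc (suc c2) + s' → Tail (suc (suc (suc c2))) (suc (suc c2))
    tail-countdown c2 s' hx = (double n + suc s') ,
      ≤-trans (+-monoʳ-≤ (double n) hs) (≤-reflexive (sym (double≡ (double n)))) ,
      realization-cong (double n + (suc s' + 0)) (2 + suc c2) (0 + suc (suc c2)) (cong (double n +_) (+-identityʳ (suc s'))) refl refl
          (perfect⊕realizationᴸ (double n) 2 0 (suc s' + 0) (suc c2) (suc (suc c2)) countdownBlock refl (tailYGrid 0 (suc c2) (suc s') (trans hx (sym (+-suc (suc c2) s')))) refl)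
      where
      hs : suc s' ≤ double n
      hs = ≤-by c2 (trans (cong (λ z → z) (+-cancelˡ-≡ 1 (double n) (suc c2 + s') hx)) (trans (sym (+-suc c2 s')) (+-comm c2 (suc s'))))

    tail-special : Tail 2 1
    tail-special = x , x≤4n , tailSpecial n' en

    tail₀ : ∀ c → Tail 0 c
    tail₀ c = x , ≤-refl , realization-size (yRealization c) (cong (_+ c) (sym (+-identityʳ x)))

    tail₁ : ∀ c → Tail 1 c
    tail₁ c = double n , ≤-by (double n) (double≡ (double n)) , xyRealization c

    tail-r≡c+1 : ∀ c → 2 ≤ suc c → c ≤ x → Tail (suc c) c
    tail-r≡c+1 zero (s≤s ()) hc
    tail-r≡c+1 (suc zero) h hc = tail-special
    tail-r≡c+1 (suc (suc c2)) h hc with ≤⇒∃+ hc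
    ... | s' , hx = tail-countdown c2 s' hx

    tail-r≡c : ∀ r → 2 ≤ r → r ≤ x → Tail r r
    tail-r≡c zero () hc
    tail-r≡c (suc c') h hc with ≤⇒∃+ hc
    ... | s , hx = tail-zigzag c' s hx

    tail-small : ∀ r c → 2 ≤ r → r < x → c ≤ x → Tail r c
    tail-small r c h2 hr hc with <-cmp r c
    ... | tri< r<c _ _ with ≤⇒∃+ r<c
    ...   | d , refl with parity d | ≤⇒∃+ hc
    ...     | Lu , inj₁ refl | s' , hx =
              Tail-cong refl (cong suc (+-comm (double Lu) r)) (tail-yGrid Lu r (suc s') (trans hx (size r (double Lu) s')))
                where
                size : ∀ r D s → suc (r + D) + s ≡ D + r + suc s
                size = solve-∀
    ...     | Lu , inj₂ refl | s' , hx =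
              Tail-cong refl (cong suc (trans (cong suc (+-comm (double Lu) r)) (sym (+-suc r (double Lu))))) (tail-yGrid′ Lu r (suc s') (trans hx (size r (double Lu) s')))
                where
                size : ∀ r D s → suc (r + suc D) + s ≡ D + suc r + suc s
                size = solve-∀
    tail-small r c h2 hr hc | tri≈ _ refl _ = tail-r≡c r h2 hc
    tail-small r c h2 hr hc | tri> _ _ c<r with ≤⇒∃+ c<r
    ...   | zero , refl = Tail-cong (cong suc (sym (+-identityʳ c))) refl (tail-r≡c+1 c (subst (2 ≤_) (cong suc (+-identityʳ c)) h2) hc)
    ...   | suc d , refl with parity d | ≤⇒∃+ (≤-trans (n≤1+n (suc c + suc d)) hr)
    ...     | Lu , inj₁ refl | s , hx =
              Tail-cong (sym (cong suc (+-suc c (double Lu)))) refl (tail-xGrid Lu c s (trans hx (size c (double Lu) s)))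
                where
                size : ∀ c D s → suc c + suc D + s ≡ suc (c + (D + 1)) + s
                size = solve-∀
    ...     | Lu , inj₂ refl | s , hx =
              Tail-cong (xs c (double Lu)) refl (tail-xGrid′ Lu c s (trans hx (size c (double Lu) s)))
                where
                xs : ∀ c D → suc (suc (suc (c + D))) ≡ suc c + suc (suc D)
                xs = solve-∀
                size : ∀ c D s → suc c + suc (suc D) + s ≡ suc (c + (D + 2)) + s
                size = solve-∀

    tail≥2 : ∀ r c → 2 ≤ r → r < x → Tail r c
    tail≥2 r c h2 hr with suc x ≤? c
    ... | no nyc = tail-small r c h2 hr (≤-pred (≰⇒> nyc))
    ... | yes yc with ≤⇒∃+ yc
    ...   | c' , refl with parity r
    ...     | zero , inj₁ refl = ⊥-elim (noLe h2)
      where noLe : 2 ≤ 0 → ⊥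
            noLe ()
    ...     | suc k , inj₁ refl with ≤⇒∃+ (≤-trans (n≤1+n k) (double-≤⇒≤ (suc k) n (≤-pred hr)))
    ...       | t , en2 = tail-even k t c' en2
    tail≥2 r c h2 hr | yes yc | c' , refl | zero , inj₂ refl = ⊥-elim (noLe h2)
      where noLe : 2 ≤ 1 → ⊥
            noLe (s≤s ())
    tail≥2 r c h2 hr | yes yc | c' , refl | suc k0 , inj₂ refl with ≤⇒∃+ (double-≤⇒≤ (suc k0) n (≤-trans (n≤1+n _) (≤-pred hr)))
    ...       | t , en2 = tail-odd k0 t c' en2

    tail : ∀ r c → r < x → Tail r c
    tail zero c hr = tail₀ c
    tail (suc zero) c hr = tail₁ c
    tail (suc (suc r)) c hr = tail≥2 (suc (suc r)) c (s≤s (s≤s z≤n)) hr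

    divModX : ∀ N → Σ ℕ λ Q → Σ ℕ λ ρ → (ρ < x) × (N ≡ Q * x + ρ)
    divModX N = N / x , N % x , m%n<n N x , trans (m≡m%n+[m/n]*n N x) (+-comm (N % x) _)

    mixedBlocks : ∀ m → Perfect (m * (x + y)) (L 0 (m * x) (m * y))
    mixedBlocks zero = perfect [] ↭-refl (walk-[] 0)
    mixedBlocks (suc m) = perfect-↭ (perfect⊕perfect (mixedBlock n 0 (sym (+-identityʳ n))) (mixedBlocks m)) (L-++ 0 x y 0 (m * x) (m * y))

    emptyPerfect : Perfect 0 (L 0 0 0)
    emptyPerfect = perfect [] ↭-refl (walk-[] 0)

    -- ones ⊕ body ⊕ tail: any surplus of 1's is spent as an initial run.
    assemble : ∀ a b c {N1 N2} a1 b1 c1 a2 b2 c2 → Perfect N1 (L a1 b1 c1) → N1 ≡ a1 + b1 + c1 →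
               Realization N2 (L a2 b2 c2) → N2 ≡ a2 + b2 + c2 → a1 + a2 ≤ a → b ≡ b1 + b2 → c ≡ c1 + c2 → Realization (a + b + c) (L a b c)
    assemble a b c a1 b1 c1 a2 b2 c2 P e1 R e2 hle eb ec with ≤⇒∃+ hle
    ... | e , ea =
      realization-cong ((e + a1) + a2) ((0 + b1) + b2) ((0 + c1) + c2) (sym (trans ea (ones a1 a2 e))) (sym eb) (sym ec)
        (perfect⊕realizationᴸ (e + a1) (0 + b1) (0 + c1) a2 b2 c2
           (perfect-↭ (perfect⊕perfect (perfect-↭ (onesPerfect e) (ones≡L e)) P) (L-++ e 0 0 a1 b1 c1))
           (trans (cong (e +_) e1) (size e a1 b1 c1)) R e2)
      where
      ones : ∀ a1 a2 e → a1 + a2 + e ≡ e + a1 + a2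
      ones = solve-∀
      size : ∀ e a1 b1 c1 → e + (a1 + b1 + c1) ≡ (e + a1) + (0 + b1) + (0 + c1)
      size = solve-∀

    onesBound≤4n : ∀ r → onesBound r ≤ double (double n)
    onesBound≤4n zero = x≤4n
    onesBound≤4n (suc r) = ≤-refl

    1+x≤4n : suc x ≤ double (double n)
    1+x≤4n = ≤-by (double n') (trans (cong (λ z → double (double z)) en)
             (trans (cong (λ z → suc (suc (suc (suc z)))) (double≡ (double n'))) (sym (cong (λ z → suc (suc (double z)) + double n') en))))

    hyp₁ : ∀ {a'} → 3 * x ∸ 3 ≤ a' → double n + double (double n) ≤ a'
    hyp₁ {a'} h = subst (_≤ a') (trans (cong (_∸ 3) (size (double n))) (trans (m+n∸n≡m _ 3) (cong (double n +_) (sym (double≡ (double n)))))) h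
      where
      size : ∀ D → 3 * suc D ≡ (D + (D + D)) + 3
      size = solve-∀

    hyp₃ : ∀ {a'} → 2 * x ∸ 2 ≤ a' → double (double n) ≤ a'
    hyp₃ {a'} h = subst (_≤ a') (trans (cong (_∸ 2) (size (double n))) (trans (m+n∸n≡m _ 2) (sym (double≡ (double n))))) h
      where
      size : ∀ D → 2 * suc D ≡ (D + D) + 2
      size = solve-∀

    hyp₂ : ∀ {a'} b' → b' + 2 * x ∸ 3 ≤ a' → b' + double (double n) ≤ suc a'
    hyp₂ {a'} b' h = subst (_≤ suc a') (sym eq2) (s≤s (subst (_≤ a') eq1 h))
      where
      E = double n'
      size : ∀ b E → b + 2 * suc (suc (suc E)) ≡ (b + suc (suc (suc (E + E)))) + 3
      size = solve-∀
      hx : x ≡ suc (suc (suc E))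
      hx = cong (λ z → suc (double z)) en
      eq1 : b' + 2 * x ∸ 3 ≡ b' + suc (suc (suc (E + E)))
      eq1 = trans (cong (λ z → b' + 2 * z ∸ 3) hx) (trans (cong (_∸ 3) (size b' E)) (m+n∸n≡m _ 3))
      eq2 : b' + double (double n) ≡ suc (b' + suc (suc (suc (E + E))))
      eq2 = trans (cong (λ z → b' + double (double z)) en) (trans (cong (λ z → b' + suc (suc (suc (suc z)))) (double≡ E)) (+-suc b' _))

    xSnake-size : ∀ m → m * x + double n ≡ double n + x * m + 0
    xSnake-size m = size (double n) m x
      where
      size : ∀ D m x → m * x + D ≡ D + x * m + 0
      size = solve-∀

    case₁ : ∀ a b c m r → r < x → b ≡ m * x + r → double n + double (double n) ≤ a → Realization (a + b + c) (L a b c)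
    case₁ a b c zero r hr eb h1 with tail r c hr
    ... | a2 , ha2 , R = assemble a b c 0 0 0 a2 r c emptyPerfect refl R refl
                           (≤-trans ha2 (≤-trans (onesBound≤4n r) (≤-trans (m≤n+m _ (double n)) h1))) eb refl
    case₁ a b c (suc m) r hr eb h1 with tail r c hr
    ... | a2 , ha2 , R = assemble a b c (double n) (x * suc m) 0 a2 r c (xSnake (suc m)) (xSnake-size (suc m)) R refl
                           (≤-trans (+-monoʳ-≤ (double n) (≤-trans ha2 (onesBound≤4n r))) h1)
                           (trans eb (cong (_+ r) (*-comm (suc m) x))) refl

    case₂ : ∀ a b c m r → r < x → b ≡ m * x + r → b + double (double n) ≤ suc a → Realization (a + b + c) (L a b c)
    case₂ a b c zero zero hr eb h2 with tail 0 c hr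
    ... | a2 , ha2 , R = assemble a b c 0 0 0 a2 0 c emptyPerfect refl R refl
                           (≤-trans ha2 (≤-pred (≤-trans 1+x≤4n (subst (λ z → z + double (double n) ≤ suc a) eb h2)))) eb refl
    case₂ a b c zero (suc r) hr eb h2 with tail (suc r) c hr
    ... | a2 , ha2 , R = assemble a b c 0 0 0 a2 (suc r) c emptyPerfect refl R refl
                           (≤-trans ha2 (≤-trans (m≤n+m _ r) (≤-pred (subst (λ z → z + double (double n) ≤ suc a) eb h2)))) eb refl
    case₂ a b c (suc m) r hr eb h2 with tail r c hr
    ... | a2 , ha2 , R = assemble a b c (double n) (x * suc m) 0 a2 r c (xSnake (suc m)) (xSnake-size (suc m)) R refl
                           (≤-trans (+-monoʳ-≤ (double n) (≤-trans ha2 (onesBound≤4n r))) (≤-pred (≤-trans (+-monoˡ-≤ (double (double n)) xb) h2)))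
                           (trans eb (cong (_+ r) (*-comm (suc m) x))) refl
      where
      xb : x ≤ b
      xb = subst (x ≤_) (sym eb) (≤-trans (m≤m+n x (m * x)) (m≤m+n (suc m * x) r))

    case₃ : ∀ a b c m r → r < x → b ≡ m * x + r → 4 * b ≤ 3 * c → double (double n) ≤ a → Realization (a + b + c) (L a b c)
    case₃ a b c m r hr eb h4 h3 with ≤⇒∃+ myc
      where
      size : ∀ m F → 3 * (m * suc (suc (suc (suc (F + F))))) + m * (F + F) ≡ 4 * (m * suc (suc (suc (F + F))))
      size = solve-∀
      hxE : x ≡ suc (suc (suc (n' + n')))
      hxE = trans (cong (λ z → suc (double z)) en) (cong (λ z → suc (suc (suc z))) (double≡ n'))
      eqZ : 4 * (m * x) ≡ 3 * (m * y) + m * double n'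
      eqZ = trans (cong (λ z → 4 * (m * z)) hxE) (trans (sym (size m n')) (sym (cong₂ (λ u v → 3 * (m * suc u) + m * v) hxE (double≡ n'))))
      mxb : m * x ≤ b
      mxb = subst (m * x ≤_) (sym eb) (m≤m+n (m * x) r)
      myc : m * y ≤ c
      myc = *-cancelˡ-≤ 3 (≤-trans (≤-by (m * double n') eqZ) (≤-trans (*-monoʳ-≤ 4 mxb) h4))
    ... | c' , ec with tail r c' hr
    ...   | a2 , ha2 , R = assemble a b c 0 (m * x) (m * y) a2 r c' (mixedBlocks m) (*-distribˡ-+ m x y) R refl
                             (≤-trans ha2 (≤-trans (onesBound≤4n r) h3)) eb ec

    realizationL3 : ∀ a b c → (3 * x ∸ 3 ≤ a) ⊎ (b + 2 * x ∸ 3 ≤ a) ⊎ ((4 * b ≤ 3 * c) × (2 * x ∸ 2 ≤ a)) → Realization (a + b + c) (L a b c)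
    realizationL3 a b c h with divModX b
    ... | m , r , hr , eb with h
    ...   | inj₁ h1 = case₁ a b c m r hr eb (hyp₁ h1)
    ...   | inj₂ (inj₁ h2) = case₂ a b c m r hr eb (hyp₂ b h2)
    ...   | inj₂ (inj₂ (h4 , h3)) = case₃ a b c m r hr eb h4 (hyp₃ h3)

theorem3p9 : (x a b c : ℕ) → x ≥ 3 → x % 2 ≡ 1 →
    ((a ≥ 3 * x ∸ 3) ⊎ (a ≥ b + 2 * x ∸ 3) ⊎ ((3 * c ≥ 4 * b) × (a ≥ 2 * x ∸ 2))) →
    Σ (List ℕ) (λ xs → IsStandardLinearRealization (L3 x a b c) xs)
theorem3p9 x a b c x≥3 odd hyp with odd≥3 x x≥3 odd
... | n' , refl = standardRealization x a b c (Blocks.Tails.realizationL3 (suc n') n' refl a b c hyp)
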